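{- Let $q$ and $t$ be non-empty patterns each of which ends in its largest entry, let $u,v$ be integers with $1\le v<u$, and for a positive integer $w$ let $i_w$ denote the increasing pattern $12\cdots w$. Then for all positive integers $n$, \[S_{n,132}\Big(\big((q\oplus i_v)\ominus t\big)\oplus i_{u-v}\Big)=S_{n,132}\big((q\ominus t)\oplus i_u\big).\]
   Context: A pattern of length $k$ is a permutation $q=q_1\cdots q_k$ of $\{1,\dots,k\}$. A permutation $p=p_1\cdots p_n$ contains $q$ if there are indices $i_1<\cdots<i_k$ with $p_{i_t}<p_{i_u}$ iff $q_t<q_u$ for all $t,u$; each such subsequence is a copy of $q$; $p$ avoids $q$ if it contains no copy. $S_{n,r}(q)$ denotes the total number of copies of $q$ in all $r$-avoiding permutations of length $n$. For patterns $q$ of length $k$ and $t$ of length $m$: $q\oplus t$ is the pattern of length $k+m$ with $(q\oplus t)_i=q_i$ for $i\le k$ and $(q\oplus t)_i=t_{i-k}+k$ for $i>k$; $q\ominus t$ is the pattern of length $k+m$ with $(q\ominus t)_i=q_i+m$ for $i\le k$ and $(q\ominus t)_i=t_{i-k}$ for $i>k$. -}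

module Defs where

open import Data.Nat using (ℕ; zero; suc; _+_; _∸_; _<_; _≤_; _<ᵇ_)
open import Data.Bool using (Bool; true; false; _∧_; if_then_else_)
open import Data.List using (List; []; _∷_; _++_; map; length; concatMap; upTo; filter)
open import Data.Nat.ListAction using (sum)
open import Data.List.Relation.Unary.Unique.Propositional using (Unique)
open import Data.List.Relation.Unary.All using (All)
open import Data.List.Membership.Propositional using (_∈_)
open import Data.Product using (_×_)

-- Patterns / permutations are lists of naturals (one-line notation).

IsPerm : List ℕ → Set
IsPerm p = Unique p × All (λ x → 1 ≤ x × x ≤ length p) p

insertions : ℕ → List ℕ → List (List ℕ)
insertions x [] = (x ∷ []) ∷ []
insertions x (y ∷ ys) = (x ∷ y ∷ ys) ∷ map (y ∷_) (insertions x ys)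

perms : ℕ → List (List ℕ)
perms zero = [] ∷ []
perms (suc n) = concatMap (insertions (suc n)) (perms n)

-- all subsequences (choices of index sets; each index set counted once)
subseqs : List ℕ → List (List ℕ)
subseqs [] = [] ∷ []
subseqs (x ∷ xs) = map (x ∷_) (subseqs xs) ++ subseqs xs

_==ᵇ_ : Bool → Bool → Bool
true ==ᵇ b = b
false ==ᵇ true = false
false ==ᵇ false = true

sameRel : ℕ → List ℕ → ℕ → List ℕ → Bool
sameRel x (a ∷ as) y (b ∷ bs) =
  ((x <ᵇ a) ==ᵇ (y <ᵇ b)) ∧ ((a <ᵇ x) ==ᵇ (b <ᵇ y)) ∧ sameRel x as y bs
sameRel _ [] _ [] = true
sameRel _ _ _ _ = false

-- order isomorphic: same length, and s_t < s_u iff q_t < q_u for all t,u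
orderIso : List ℕ → List ℕ → Bool
orderIso [] [] = true
orderIso (x ∷ xs) (y ∷ ys) = sameRel x xs y ys ∧ orderIso xs ys
orderIso _ _ = false

copies : List ℕ → List ℕ → ℕ
copies q p = length (filter (λ s → Data.Bool._≟_ (orderIso s q) true) (subseqs p))

contains : List ℕ → List ℕ → Bool
contains q p with copies q p
... | zero = false
... | suc _ = true

avoids : List ℕ → List ℕ → Bool
avoids r p = if contains r p then false else true

S : ℕ → List ℕ → List ℕ → ℕ
S n r q = sum (map (copies q) (filter (λ p → Data.Bool._≟_ (avoids r p) true) (perms n)))

_⊕_ : List ℕ → List ℕ → List ℕ
q ⊕ t = q ++ map (λ x → x + length q) t

_⊖_ : List ℕ → List ℕ → List ℕ
q ⊖ t = map (λ x → x + length t) q ++ t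

inc : ℕ → List ℕ
inc w = map suc (upTo w)

-- last entry of a list (0 for the empty list; only used on non-empty lists)
lastEntry : List ℕ → ℕ
lastEntry [] = 0
lastEntry (x ∷ []) = x
lastEntry (x ∷ y ∷ ys) = lastEntry (y ∷ ys)

EndsInLargest : List ℕ → Set
EndsInLargest q = All (λ x → x ≤ lastEntry q) q

NonEmpty : List ℕ → Set
NonEmpty q = 1 ≤ length q

-- Write F_σ for the generating function of S_{n,132}(σ) and C for that of the Catalan numbers.
-- A 132-avoider of length n + 1 is L (n + 1) R with L above R, both 132-avoiding. If σ = τ m
-- ends in its maximum, a copy of σ lies in L, lies in R, or is a copy of τ in L followed by
-- n + 1, so F_σ = 2xC F_σ + xC F_τ. If σ = X ⊖ T with X = χ m₁ and T both ending in their
-- maxima, a copy may also be a copy of X in L followed by one of T in R, or of χ in L, then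
-- n + 1, then one of T in R, so F_σ = 2xC F_σ + x(F_X + F_χ) F_T. Both identities have the
-- form G = 2xC G + H, which determines G from H. For Y_v = (q ⊕ i_v) ⊖ t, the skew identity,
-- the one for q ⊕ i_v, and the commutation of xC with x F_t give F_{Y_{v+1}} = 2xC F_{Y_{v+1}}
-- + xC F_{Y_v}: the recurrence relating F_{P ⊕ i_{w+1}} to F_{P ⊕ i_w}. Hence by induction
-- F_{Y_v ⊕ i_w} = F_{Y_0 ⊕ i_{v+w}}, and Y_0 = q ⊖ t.

module Submission where

open import Defs
open import Data.Nat using (ℕ; zero; suc; _+_; _*_; _∸_; _<_; _≤_; _<ᵇ_; z≤n; s≤s; s≤s⁻¹)
open import Data.Nat.Properties
open import Data.Nat.Induction using (<-rec)
open import Data.Nat.ListAction using (sum)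
open import Data.Nat.Tactic.RingSolver using (solve-∀)
open import Data.Bool using (Bool; true; false; _∧_)
open import Data.Bool.Properties using (∧-assoc; ∧-zeroʳ; ∧-identityʳ)
open import Data.List using (List; []; _∷_; _++_; _∷ʳ_; map; length; concatMap; filter; take; drop; null; upTo)
open import Data.List.Properties
  using (++-assoc; ++-identityʳ; length-++; length-map; length-take; map-++; map-∘; map-cong; take++drop≡id; upTo-∷ʳ; length-upTo)
open import Data.List.Relation.Unary.All using (All; []; _∷_)
import Data.List.Relation.Unary.All as All
import Data.List.Relation.Unary.All.Properties as All
open import Data.List.Relation.Unary.Any using (here; there)
open import Data.List.Relation.Unary.Unique.Propositional using (Unique; []; _∷_)
open import Data.List.Membership.Propositional using (_∈_)
open import Data.List.Membership.Propositional.Properties using (∈-++⁺ˡ; ∈-++⁺ʳ; ∈-map⁺)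
open import Data.Product using (Σ; _×_; _,_; proj₁; proj₂)
open import Data.Unit using (tt)
open import Relation.Nullary using (contradiction; yes; no)
open import Relation.Binary.Definitions using (tri<; tri≈; tri>)
open import Relation.Binary.PropositionalEquality

private variable A B : Set

∑ : (A → ℕ) → List A → ℕ
∑ f xs = sum (map f xs)

𝟙 : Bool → ℕ
𝟙 true  = 1
𝟙 false = 0

keepIf : Bool → ℕ → ℕ
keepIf true  n = n
keepIf false _ = 0

∑-++ : (f : A → ℕ) (xs ys : List A) → ∑ f (xs ++ ys) ≡ ∑ f xs + ∑ f ys
∑-++ f []       ys = refl
∑-++ f (x ∷ xs) ys = trans (cong (f x +_) (∑-++ f xs ys)) (sym (+-assoc (f x) _ _))

∑-map : (f : B → ℕ) (g : A → B) (xs : List A) → ∑ f (map g xs) ≡ ∑ (λ x → f (g x)) xs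
∑-map f g []       = refl
∑-map f g (x ∷ xs) = cong (f (g x) +_) (∑-map f g xs)

∑-concatMap : (f : B → ℕ) (g : A → List B) (xs : List A) →
  ∑ f (concatMap g xs) ≡ ∑ (λ x → ∑ f (g x)) xs
∑-concatMap f g []       = refl
∑-concatMap f g (x ∷ xs) = trans (∑-++ f (g x) (concatMap g xs)) (cong (∑ f (g x) +_) (∑-concatMap f g xs))

∑-congᴬ : {f g : A → ℕ} {xs : List A} → All (λ x → f x ≡ g x) xs → ∑ f xs ≡ ∑ g xs
∑-congᴬ []       = refl
∑-congᴬ (e ∷ es) = cong₂ _+_ e (∑-congᴬ es)

∑-cong : {f g : A → ℕ} → (∀ x → f x ≡ g x) → (xs : List A) → ∑ f xs ≡ ∑ g xs
∑-cong e []       = refl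
∑-cong e (x ∷ xs) = cong₂ _+_ (e x) (∑-cong e xs)

∑-zero : {f : A → ℕ} {xs : List A} → All (λ x → f x ≡ 0) xs → ∑ f xs ≡ 0
∑-zero []       = refl
∑-zero (e ∷ es) = cong₂ _+_ e (∑-zero es)

∑-+ : (f g : A → ℕ) (xs : List A) → ∑ (λ x → f x + g x) xs ≡ ∑ f xs + ∑ g xs
∑-+ f g []       = refl
∑-+ f g (x ∷ xs) = trans (cong (f x + g x +_) (∑-+ f g xs)) (interchange (f x) (g x) _ _)
  where
  interchange : ∀ a b c d → a + b + (c + d) ≡ a + c + (b + d)
  interchange = solve-∀

∑-*ˡ : (k : ℕ) (f : A → ℕ) (xs : List A) → ∑ (λ x → k * f x) xs ≡ k * ∑ f xs
∑-*ˡ k f []       = sym (*-zeroʳ k)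
∑-*ˡ k f (x ∷ xs) = trans (cong (k * f x +_) (∑-*ˡ k f xs)) (sym (*-distribˡ-+ k (f x) _))

∑-*ʳ : (k : ℕ) (f : A → ℕ) (xs : List A) → ∑ (λ x → f x * k) xs ≡ ∑ f xs * k
∑-*ʳ k f xs = trans (∑-cong (λ x → *-comm (f x) k) xs) (trans (∑-*ˡ k f xs) (*-comm k _))

∑-keepIf : (c : Bool) (f : A → ℕ) (xs : List A) → ∑ (λ x → keepIf c (f x)) xs ≡ keepIf c (∑ f xs)
∑-keepIf true  f xs = refl
∑-keepIf false f xs = ∑-zero (All.universal (λ _ → refl) xs)

∑-zero-at : (f : A → ℕ) (xs : List A) → ∑ f xs ≡ 0 → All (λ x → f x ≡ 0) xs
∑-zero-at f []       e = []
∑-zero-at f (x ∷ xs) e = m+n≡0⇒m≡0 (f x) e ∷ ∑-zero-at f xs (m+n≡0⇒n≡0 (f x) e)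

length-filter : (b : A → Bool) (xs : List A) →
  length (filter (λ x → Data.Bool._≟_ (b x) true) xs) ≡ ∑ (λ x → 𝟙 (b x)) xs
length-filter b []       = refl
length-filter b (x ∷ xs) with b x
... | true  = cong suc (length-filter b xs)
... | false = length-filter b xs

∑-filter : (b : A → Bool) (f : A → ℕ) (xs : List A) →
  ∑ f (filter (λ x → Data.Bool._≟_ (b x) true) xs) ≡ ∑ (λ x → keepIf (b x) (f x)) xs
∑-filter b f []       = refl
∑-filter b f (x ∷ xs) with b x
... | true  = cong (f x +_) (∑-filter b f xs)
... | false = ∑-filter b f xs

∧-true-left : ∀ {a b} → a ∧ b ≡ true → a ≡ true
∧-true-left {true} _ = refl

∧-true-right : ∀ {a b} → a ∧ b ≡ true → b ≡ true
∧-true-right {true} e = e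

==ᵇ-true : ∀ {c d} → (c ==ᵇ d) ≡ true → d ≡ c
==ᵇ-true {true}  {true}  _ = refl
==ᵇ-true {false} {false} _ = refl

==ᵇ-refl : ∀ c → (c ==ᵇ c) ≡ true
==ᵇ-refl true  = refl
==ᵇ-refl false = refl

<⇒<ᵇ≡true : ∀ {m n} → m < n → (m <ᵇ n) ≡ true
<⇒<ᵇ≡true {m} {n} m<n with m <ᵇ n | <⇒<ᵇ m<n
... | true | _ = refl

≤⇒<ᵇ≡false : ∀ {m n} → n ≤ m → (m <ᵇ n) ≡ false
≤⇒<ᵇ≡false {m} {n} n≤m with m <ᵇ n in eq
... | false = refl
... | true  = contradiction (<ᵇ⇒< m n (subst Data.Bool.T (sym eq) tt)) (≤⇒≯ n≤m)

<ᵇ≡true⇒< : ∀ {m n} → (m <ᵇ n) ≡ true → m < n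
<ᵇ≡true⇒< {m} {n} e = <ᵇ⇒< m n (subst Data.Bool.T (sym e) tt)

-- (c₁ , c₂) records the outcome of (x <ᵇ z , z <ᵇ x): (false , true) says x lies above z,
-- (true , false) that it lies below.
Relates : Bool → Bool → ℕ → ℕ → Set
Relates c₁ c₂ x z = ((x <ᵇ z) ≡ c₁) × ((z <ᵇ x) ≡ c₂)

AllRelate : Bool → Bool → List ℕ → List ℕ → Set
AllRelate c₁ c₂ a b = All (λ x → All (Relates c₁ c₂ x) b) a

relatesToAll : Bool → Bool → ℕ → List ℕ → Bool
relatesToAll c₁ c₂ y []      = true
relatesToAll c₁ c₂ y (r ∷ ρ) = ((c₁ ==ᵇ (y <ᵇ r)) ∧ (c₂ ==ᵇ (r <ᵇ y))) ∧ relatesToAll c₁ c₂ y ρ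

relatesAcross : Bool → Bool → List ℕ → List ℕ → Bool
relatesAcross c₁ c₂ []       ρ₂ = true
relatesAcross c₁ c₂ (y ∷ ρ₁) ρ₂ = relatesToAll c₁ c₂ y ρ₂ ∧ relatesAcross c₁ c₂ ρ₁ ρ₂

relatesToAll-sound : ∀ {c₁ c₂ y r ρ} → relatesToAll c₁ c₂ y ρ ≡ true → r ∈ ρ → Relates c₁ c₂ y r
relatesToAll-sound {c₁} {c₂} {y} {ρ = r ∷ ρ} e (here refl) =
  ==ᵇ-true (∧-true-left (∧-true-left {b = relatesToAll c₁ c₂ y ρ} e)) ,
  ==ᵇ-true (∧-true-right {c₁ ==ᵇ (y <ᵇ r)} (∧-true-left {b = relatesToAll c₁ c₂ y ρ} e))
relatesToAll-sound {c₁} {c₂} {y} {ρ = r ∷ _} e (there r∈ρ) =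
  relatesToAll-sound (∧-true-right {(c₁ ==ᵇ (y <ᵇ r)) ∧ (c₂ ==ᵇ (r <ᵇ y))} e) r∈ρ

relatesAcross-sound : ∀ {c₁ c₂ y r ρ₁ ρ₂} → relatesAcross c₁ c₂ ρ₁ ρ₂ ≡ true →
  y ∈ ρ₁ → r ∈ ρ₂ → Relates c₁ c₂ y r
relatesAcross-sound e (here refl) r∈ρ₂ = relatesToAll-sound (∧-true-left e) r∈ρ₂
relatesAcross-sound {c₁} {c₂} {ρ₁ = y′ ∷ _} {ρ₂} e (there y∈ρ₁) r∈ρ₂ =
  relatesAcross-sound (∧-true-right {relatesToAll c₁ c₂ y′ ρ₂} e) y∈ρ₁ r∈ρ₂

relatesToAll-complete : ∀ {c₁ c₂ y ρ} → All (Relates c₁ c₂ y) ρ → relatesToAll c₁ c₂ y ρ ≡ true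
relatesToAll-complete [] = refl
relatesToAll-complete {c₁} {c₂} ((e₁ , e₂) ∷ h)
  rewrite e₁ | e₂ | ==ᵇ-refl c₁ | ==ᵇ-refl c₂ = relatesToAll-complete h

relatesAcross-complete : ∀ {c₁ c₂ ρ₁ ρ₂} → AllRelate c₁ c₂ ρ₁ ρ₂ → relatesAcross c₁ c₂ ρ₁ ρ₂ ≡ true
relatesAcross-complete []       = refl
relatesAcross-complete (h ∷ hs) rewrite relatesToAll-complete h = relatesAcross-complete hs

orderIso⇒length≡ : (a ρ : List ℕ) → orderIso a ρ ≡ true → length a ≡ length ρ
orderIso⇒length≡ []      []      _ = refl
orderIso⇒length≡ (x ∷ a) (y ∷ ρ) e = cong suc (orderIso⇒length≡ a ρ (∧-true-right {sameRel x a y ρ} e))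

length≢⇒orderIso≡false : (a ρ : List ℕ) → length a ≢ length ρ → orderIso a ρ ≡ false
length≢⇒orderIso≡false a ρ ne with orderIso a ρ in e
... | false = refl
... | true  = contradiction (orderIso⇒length≡ a ρ e) ne

sameRel-++ : ∀ x y (a b ρ₁ ρ₂ : List ℕ) → length a ≡ length ρ₁ →
  sameRel x (a ++ b) y (ρ₁ ++ ρ₂) ≡ sameRel x a y ρ₁ ∧ sameRel x b y ρ₂
sameRel-++ x y []      b []       ρ₂ _ = refl
sameRel-++ x y (z ∷ a) b (r ∷ ρ₁) ρ₂ e rewrite sameRel-++ x y a b ρ₁ ρ₂ (suc-injective e) =
  trans (cong (P ∧_) (sym (∧-assoc Q (sameRel x a y ρ₁) (sameRel x b y ρ₂))))
        (sym (∧-assoc P (Q ∧ sameRel x a y ρ₁) (sameRel x b y ρ₂)))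
  where
  P = (x <ᵇ z) ==ᵇ (y <ᵇ r)
  Q = (z <ᵇ x) ==ᵇ (r <ᵇ y)

sameRel-uniform : ∀ {c₁ c₂ x y} {b ρ : List ℕ} → All (Relates c₁ c₂ x) b → length b ≡ length ρ →
  sameRel x b y ρ ≡ relatesToAll c₁ c₂ y ρ
sameRel-uniform {b = []} {[]} [] _ = refl
sameRel-uniform {c₁} {c₂} {x} {y} {z ∷ b} {r ∷ ρ} ((e₁ , e₂) ∷ h) e
  rewrite e₁ | e₂ | sameRel-uniform {y = y} {ρ = ρ} h (suc-injective e) =
  sym (∧-assoc (c₁ ==ᵇ (y <ᵇ r)) (c₂ ==ᵇ (r <ᵇ y)) (relatesToAll c₁ c₂ y ρ))

orderIso-++ : ∀ {c₁ c₂} (a b ρ₁ ρ₂ : List ℕ) → length a ≡ length ρ₁ → AllRelate c₁ c₂ a b →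
  orderIso (a ++ b) (ρ₁ ++ ρ₂) ≡ orderIso a ρ₁ ∧ orderIso b ρ₂ ∧ relatesAcross c₁ c₂ ρ₁ ρ₂
orderIso-++ []      b []       ρ₂ _ _ = sym (∧-identityʳ (orderIso b ρ₂))
orderIso-++ {c₁} {c₂} (x ∷ a) b (y ∷ ρ₁) ρ₂ e (hx ∷ h)
  rewrite sameRel-++ x y a b ρ₁ ρ₂ (suc-injective e) | orderIso-++ {c₁} {c₂} a b ρ₁ ρ₂ (suc-injective e) h =
  rearrange (sameRel x a y ρ₁) (sameRel x b y ρ₂) (orderIso a ρ₁) (orderIso b ρ₂)
            (relatesAcross c₁ c₂ ρ₁ ρ₂) (relatesToAll c₁ c₂ y ρ₂) uniform
  where
  uniform : sameRel x b y ρ₂ ∧ orderIso b ρ₂ ≡ relatesToAll c₁ c₂ y ρ₂ ∧ orderIso b ρ₂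
  uniform with orderIso b ρ₂ in eq
  ... | false = trans (∧-zeroʳ _) (sym (∧-zeroʳ _))
  ... | true  = cong (_∧ true) (sameRel-uniform hx (orderIso⇒length≡ b ρ₂ eq))

  rearrange : ∀ A B C D E F → B ∧ D ≡ F ∧ D → (A ∧ B) ∧ (C ∧ D ∧ E) ≡ (A ∧ C) ∧ D ∧ (F ∧ E)
  rearrange false _     _     _     _ _     _ = refl
  rearrange true  B     false _     _ _     _ = ∧-zeroʳ B
  rearrange true  B     true  false _ _     _ = ∧-zeroʳ B
  rearrange true  false true  true  _ false _ = refl
  rearrange true  true  true  true  _ true  _ = refl
  rearrange true  false true  true  _ true  ()
  rearrange true  true  true  true  _ false ()

copy-++⇒Relates : ∀ {c₁ c₂} (a b σ : List ℕ) → AllRelate c₁ c₂ a b → orderIso (a ++ b) σ ≡ true →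
  ∀ {y r} → y ∈ take (length a) σ → r ∈ drop (length a) σ → Relates c₁ c₂ y r
copy-++⇒Relates {c₁} {c₂} a b σ h e =
  relatesAcross-sound (∧-true-right {orderIso b (drop k σ)} (∧-true-right {orderIso a (take k σ)} split))
  where
  k = length a
  length-take≡ : length a ≡ length (take k σ)
  length-take≡ = sym (trans (length-take k σ) (m≤n⇒m⊓n≡m (subst (k ≤_) lengths (m≤m+n k (length b)))))
    where
    lengths : k + length b ≡ length σ
    lengths = trans (sym (length-++ a)) (orderIso⇒length≡ (a ++ b) σ e)
  split : orderIso a (take k σ) ∧ orderIso b (drop k σ) ∧ relatesAcross c₁ c₂ (take k σ) (drop k σ) ≡ true
  split = trans (sym (orderIso-++ a b (take k σ) (drop k σ) length-take≡ h))
                (trans (cong (orderIso (a ++ b)) (take++drop≡id k σ)) e)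

∑-subseqs-++ : (g : List ℕ → ℕ) (xs ys : List ℕ) →
  ∑ g (subseqs (xs ++ ys)) ≡ ∑ (λ a → ∑ (λ b → g (a ++ b)) (subseqs ys)) (subseqs xs)
∑-subseqs-++ g []       ys = sym (+-identityʳ _)
∑-subseqs-++ g (x ∷ xs) ys = begin
  ∑ g (map (x ∷_) (subseqs (xs ++ ys)) ++ subseqs (xs ++ ys))
    ≡⟨ ∑-++ g (map (x ∷_) (subseqs (xs ++ ys))) _ ⟩
  ∑ g (map (x ∷_) (subseqs (xs ++ ys))) + ∑ g (subseqs (xs ++ ys))
    ≡⟨ cong₂ _+_ (trans (∑-map g (x ∷_) (subseqs (xs ++ ys))) (∑-subseqs-++ (λ s → g (x ∷ s)) xs ys))
                 (∑-subseqs-++ g xs ys) ⟩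
  ∑ (λ a → ∑ (λ b → g (x ∷ a ++ b)) (subseqs ys)) (subseqs xs)
    + ∑ (λ a → ∑ (λ b → g (a ++ b)) (subseqs ys)) (subseqs xs)
    ≡⟨ cong (_+ _) (sym (∑-map _ (x ∷_) (subseqs xs))) ⟩
  ∑ _ (map (x ∷_) (subseqs xs)) + ∑ _ (subseqs xs)
    ≡⟨ sym (∑-++ _ (map (x ∷_) (subseqs xs)) (subseqs xs)) ⟩
  ∑ (λ a → ∑ (λ b → g (a ++ b)) (subseqs ys)) (subseqs (x ∷ xs)) ∎
  where open ≡-Reasoning

∑-subseqs-map : (g : List ℕ → ℕ) (f : ℕ → ℕ) (xs : List ℕ) →
  ∑ g (subseqs (map f xs)) ≡ ∑ (λ s → g (map f s)) (subseqs xs)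
∑-subseqs-map g f []       = refl
∑-subseqs-map g f (x ∷ xs) = begin
  ∑ g (map (f x ∷_) (subseqs (map f xs)) ++ subseqs (map f xs))
    ≡⟨ ∑-++ g (map (f x ∷_) (subseqs (map f xs))) _ ⟩
  ∑ g (map (f x ∷_) (subseqs (map f xs))) + ∑ g (subseqs (map f xs))
    ≡⟨ cong₂ _+_ (trans (∑-map g (f x ∷_) (subseqs (map f xs))) (∑-subseqs-map (λ s → g (f x ∷ s)) f xs))
                 (∑-subseqs-map g f xs) ⟩
  ∑ (λ s → g (map f (x ∷ s))) (subseqs xs) + ∑ (λ s → g (map f s)) (subseqs xs)
    ≡⟨ cong (_+ _) (sym (∑-map _ (x ∷_) (subseqs xs))) ⟩
  ∑ _ (map (x ∷_) (subseqs xs)) + ∑ _ (subseqs xs)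
    ≡⟨ sym (∑-++ _ (map (x ∷_) (subseqs xs)) (subseqs xs)) ⟩
  ∑ (λ s → g (map f s)) (subseqs (x ∷ xs)) ∎
  where open ≡-Reasoning

∑-null-subseqs : (xs : List ℕ) → ∑ (λ s → 𝟙 (null s)) (subseqs xs) ≡ 1
∑-null-subseqs []       = refl
∑-null-subseqs (x ∷ xs) =
  trans (∑-++ _ (map (x ∷_) (subseqs xs)) (subseqs xs))
        (cong₂ _+_ (trans (∑-map _ (x ∷_) (subseqs xs)) (∑-zero (All.universal (λ _ → refl) (subseqs xs))))
                   (∑-null-subseqs xs))

All-subseqs : {P : ℕ → Set} (xs : List ℕ) → All P xs → All (All P) (subseqs xs)
All-subseqs []       h        = [] ∷ []
All-subseqs (x ∷ xs) (px ∷ h) = All.++⁺ (All.map⁺ (All.map (px ∷_) (All-subseqs xs h))) (All-subseqs xs h)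

[x]∈subseqs : ∀ {x : ℕ} {xs} → x ∈ xs → (x ∷ []) ∈ subseqs xs
[x]∈subseqs {x} {_ ∷ xs} (here refl) = ∈-++⁺ˡ (∈-map⁺ (x ∷_) ([]∈subseqs xs))
  where
  []∈subseqs : ∀ xs → [] ∈ subseqs xs
  []∈subseqs []       = here refl
  []∈subseqs (z ∷ xs) = ∈-++⁺ʳ (map (z ∷_) (subseqs xs)) ([]∈subseqs xs)
[x]∈subseqs {xs = y ∷ xs} (there x∈xs) = ∈-++⁺ʳ (map (y ∷_) (subseqs xs)) ([x]∈subseqs x∈xs)

Above : List ℕ → List ℕ → Set
Above L R = All (λ x → All (_< x) R) L

-- The shape L N R of a 132-avoider around its maximum N.
Layered : ℕ → List ℕ → List ℕ → Set
Layered N L R = Above L R × All (_< N) L × All (_< N) R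

Above⇒AllRelate : ∀ {a b} → Above a b → AllRelate false true a b
Above⇒AllRelate = All.map (All.map (λ z<x → ≤⇒<ᵇ≡false (<⇒≤ z<x) , <⇒<ᵇ≡true z<x))

Below⇒AllRelate : ∀ {a N} → All (_< N) a → AllRelate true false a (N ∷ [])
Below⇒AllRelate = All.map (λ x<N → (<⇒<ᵇ≡true x<N , ≤⇒<ᵇ≡false (<⇒≤ x<N)) ∷ [])

Above-subseqs : ∀ {a} R → Above a R → All (Above a) (subseqs R)
Above-subseqs []      h = All.map (λ _ → []) h ∷ []
Above-subseqs (z ∷ R) h = All.++⁺ (All.map⁺ (All.map (λ hb → All.zipWith (λ (p , q) → p ∷ q) (heads , hb)) rest)) rest
  where
  heads = All.map All.head h
  rest = Above-subseqs R (All.map All.tail h)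

Layered-subseqs : ∀ {N} L R → Layered N L R → All (λ a → All (Layered N a) (subseqs R)) (subseqs L)
Layered-subseqs {N} L R (LR , L<N , R<N) = All.map perPrefix (All-subseqs L (All.zip (LR , L<N)))
  where
  perPrefix : ∀ {a} → All (λ x → All (_< x) R × x < N) a → All (Layered N a) (subseqs R)
  perPrefix h with All.unzip h
  ... | aR , a<N = All.map (λ (ab , b<N) → ab , a<N , b<N) (All.zip (Above-subseqs R aR , All-subseqs R R<N))

-- Copies of patterns ending in their maximum and of skew sums of such

𝟙-∧ : ∀ p q → 𝟙 (p ∧ q) ≡ 𝟙 p * 𝟙 q
𝟙-∧ true  q = sym (+-identityʳ (𝟙 q))
𝟙-∧ false q = refl

length-++-∷ʳ : ∀ (P ρ : List ℕ) m → length (P ++ ρ ∷ʳ m) ≡ suc (length P + length ρ)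
length-++-∷ʳ []      []      m = refl
length-++-∷ʳ []      (x ∷ ρ) m = cong suc (length-++-∷ʳ [] ρ m)
length-++-∷ʳ (x ∷ P) ρ       m = cong suc (length-++-∷ʳ P ρ m)

0<length-∷ʳ : ∀ (a : List ℕ) N → 0 < length (a ∷ʳ N)
0<length-∷ʳ a N = subst (0 <_) (sym (length-++-∷ʳ [] a N)) (s≤s z≤n)

length-copy : ∀ a b σ → orderIso (a ++ b) σ ≡ true → length a + length b ≡ length σ
length-copy a b σ e = trans (sym (length-++ a)) (orderIso⇒length≡ (a ++ b) σ e)

orderIso-[]-∷ʳ : ∀ τ m ρ → orderIso [] (τ ++ m ∷ ρ) ≡ false
orderIso-[]-∷ʳ []      m ρ = refl
orderIso-[]-∷ʳ (x ∷ τ) m ρ = refl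

∈-take-length+suc : ∀ P {y : ℕ} ys j → y ∈ take (length P + suc j) (P ++ y ∷ ys)
∈-take-length+suc []      ys j = here refl
∈-take-length+suc (x ∷ P) ys j = there (∈-take-length+suc P ys j)

∈-drop-length+suc : ∀ P {y m : ℕ} ρ ρ′ j → j ≤ length ρ → m ∈ drop (length P + suc j) (P ++ y ∷ ρ ++ m ∷ ρ′)
∈-drop-length+suc (x ∷ P) ρ       ρ′ j       j≤ρ       = ∈-drop-length+suc P ρ ρ′ j j≤ρ
∈-drop-length+suc []      ρ       ρ′ zero    _         = ∈-++⁺ʳ ρ (here refl)
∈-drop-length+suc []      (r ∷ ρ) ρ′ (suc j) (s≤s j≤ρ) = ∈-drop-length+suc [] {r} ρ ρ′ j j≤ρ

-- The first entry of ρ and the larger m after it lie on opposite sides of the cut, but the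
-- entries before the cut must all exceed those after it.
cut-inside-ascent : ∀ P ρ m ρ′ {a b} → All (_< m) ρ → Above a b →
  length P < length a → length a ≤ length P + length ρ → orderIso (a ++ b) (P ++ ρ ++ m ∷ ρ′) ≡ false
cut-inside-ascent P [] m ρ′ _ _ P<a a≤P =
  contradiction (≤-trans a≤P (≤-reflexive (+-identityʳ (length P)))) (<⇒≱ P<a)
cut-inside-ascent P (y ∷ ρ) m ρ′ {a} {b} (y<m ∷ _) ab P<a a≤P+ρ with orderIso (a ++ b) (P ++ y ∷ ρ ++ m ∷ ρ′) in e
... | false = refl
... | true  = contradiction (trans (sym (<⇒<ᵇ≡true y<m)) (proj₁ y-above-m)) λ ()
  where
  j = length a ∸ suc (length P)
  a≡P+j : length P + suc j ≡ length a
  a≡P+j = trans (+-suc (length P) j) (m+[n∸m]≡n P<a)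
  j≤ρ : j ≤ length ρ
  j≤ρ = s≤s⁻¹ (+-cancelˡ-≤ (length P) _ _ (subst (_≤ length P + suc (length ρ)) (sym a≡P+j) a≤P+ρ))
  y-above-m : Relates false true y m
  y-above-m = copy-++⇒Relates a b _ (Above⇒AllRelate ab) e
    (subst (λ k → y ∈ take k _) a≡P+j (∈-take-length+suc P (ρ ++ m ∷ ρ′) j))
    (subst (λ k → m ∈ drop k _) a≡P+j (∈-drop-length+suc P ρ ρ′ j j≤ρ))

cut-before-final-max : ∀ P ρ m {a b} → All (_< m) ρ → Above a b →
  length P < length a → 1 ≤ length b → orderIso (a ++ b) (P ++ ρ ∷ʳ m) ≡ false
cut-before-final-max P ρ m {a} {b} ρ<m ab P<a 1≤b with orderIso (a ++ b) (P ++ ρ ∷ʳ m) in e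
... | false = refl
... | true  = trans (sym e) (cut-inside-ascent P ρ m [] ρ<m ab P<a a≤P+ρ)
  where
  a≤P+ρ : length a ≤ length P + length ρ
  a≤P+ρ = s≤s⁻¹ (begin
    suc (length a)        ≡⟨ +-comm 1 (length a) ⟩
    length a + 1          ≤⟨ +-monoʳ-≤ (length a) 1≤b ⟩
    length a + length b   ≡⟨ length-copy a b _ e ⟩
    length (P ++ ρ ∷ʳ m)  ≡⟨ length-++-∷ʳ P ρ m ⟩
    suc (length P + length ρ) ∎)
    where open ≤-Reasoning

orderIso-∷ʳ-max : ∀ a τ N m → All (_< N) a → All (_< m) τ → orderIso (a ∷ʳ N) (τ ∷ʳ m) ≡ orderIso a τ
orderIso-∷ʳ-max a τ N m a<N τ<m with length a ≟ length τ
... | yes a≡τ = begin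
  orderIso (a ∷ʳ N) (τ ∷ʳ m)
    ≡⟨ orderIso-++ a (N ∷ []) τ (m ∷ []) a≡τ (Below⇒AllRelate a<N) ⟩
  orderIso a τ ∧ true ∧ relatesAcross true false τ (m ∷ [])
    ≡⟨ cong (λ c → orderIso a τ ∧ c) (relatesAcross-complete (Below⇒AllRelate τ<m)) ⟩
  orderIso a τ ∧ true
    ≡⟨ ∧-identityʳ (orderIso a τ) ⟩
  orderIso a τ ∎
  where open ≡-Reasoning
... | no a≢τ = trans (length≢⇒orderIso≡false (a ∷ʳ N) (τ ∷ʳ m) (λ e → a≢τ (lengths e)))
                     (sym (length≢⇒orderIso≡false a τ a≢τ))
  where
  lengths : length (a ∷ʳ N) ≡ length (τ ∷ʳ m) → length a ≡ length τ
  lengths e = suc-injective (trans (sym (length-++-∷ʳ [] a N)) (trans e (length-++-∷ʳ [] τ m)))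

copy-∷ʳ-top⇒final-max : ∀ a ρ N r → All (_< N) a → orderIso (a ∷ʳ N) (ρ ∷ʳ r) ≡ true → All (_< r) ρ
copy-∷ʳ-top⇒final-max a ρ N r a<N e =
  All.tabulate λ y∈ρ → <ᵇ≡true⇒< (proj₁ (relatesAcross-sound across y∈ρ (here refl)))
  where
  a≡ρ : length a ≡ length ρ
  a≡ρ = suc-injective (trans (sym (length-++-∷ʳ [] a N))
          (trans (orderIso⇒length≡ (a ∷ʳ N) (ρ ∷ʳ r) e) (length-++-∷ʳ [] ρ r)))
  across : relatesAcross true false ρ (r ∷ []) ≡ true
  across = ∧-true-right {orderIso (N ∷ []) (r ∷ [])} (∧-true-right {orderIso a ρ}
             (trans (sym (orderIso-++ a (N ∷ []) ρ (r ∷ []) a≡ρ (Below⇒AllRelate a<N))) e))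

module MaxEnding {τ : List ℕ} {m : ℕ} (τ<m : All (_< m) τ) where

  𝟙-copy-++ : ∀ a b → Above a b →
    𝟙 (orderIso (a ++ b) (τ ∷ʳ m)) ≡
      𝟙 (orderIso a (τ ∷ʳ m)) * 𝟙 (null b) + 𝟙 (null a) * 𝟙 (orderIso b (τ ∷ʳ m))
  𝟙-copy-++ [] b _ rewrite orderIso-[]-∷ʳ τ m [] = sym (+-identityʳ _)
  𝟙-copy-++ (x ∷ a) [] _ rewrite ++-identityʳ a = sym (trans (+-identityʳ _) (*-identityʳ _))
  𝟙-copy-++ (x ∷ a) (z ∷ b) ab rewrite cut-before-final-max [] τ m τ<m ab (s≤s z≤n) (s≤s z≤n) =
    sym (trans (+-identityʳ _) (*-zeroʳ (𝟙 (orderIso (x ∷ a) (τ ∷ʳ m)))))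

  𝟙-copy-insert : ∀ N a b → Layered N a b →
    𝟙 (orderIso (a ++ N ∷ b) (τ ∷ʳ m)) ≡ 𝟙 (orderIso a τ) * 𝟙 (null b)
  𝟙-copy-insert N a [] (_ , a<N , _) rewrite orderIso-∷ʳ-max a τ N m a<N τ<m = sym (*-identityʳ _)
  𝟙-copy-insert N a (z ∷ b) (ab , a<N , b<N)
    rewrite sym (++-assoc a (N ∷ []) (z ∷ b))
          | cut-before-final-max [] τ m τ<m (All.++⁺ ab (b<N ∷ [])) (0<length-∷ʳ a N) (s≤s z≤n)
    = sym (*-zeroʳ (𝟙 (orderIso a τ)))

module Skew {χ θ : List ℕ} {m₁ m₂ : ℕ} (χ<m₁ : All (_< m₁) χ) (θ<m₂ : All (_< m₂) θ)
            (XT : Above (χ ∷ʳ m₁) (θ ∷ʳ m₂)) where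

  X = χ ∷ʳ m₁
  T = θ ∷ʳ m₂

  copy-++ : ∀ a b → Above a b → 1 ≤ length a → 1 ≤ length b →
    orderIso (a ++ b) (X ++ T) ≡ orderIso a X ∧ orderIso b T
  copy-++ a b ab 1≤a 1≤b with <-cmp (length a) (length X)
  ... | tri≈ _ a≡X _ = begin
    orderIso (a ++ b) (X ++ T)                  ≡⟨ orderIso-++ a b X T a≡X (Above⇒AllRelate ab) ⟩
    orderIso a X ∧ orderIso b T ∧ relatesAcross false true X T
      ≡⟨ cong (λ c → orderIso a X ∧ orderIso b T ∧ c) (relatesAcross-complete (Above⇒AllRelate XT)) ⟩
    orderIso a X ∧ orderIso b T ∧ true          ≡⟨ cong (orderIso a X ∧_) (∧-identityʳ (orderIso b T)) ⟩
    orderIso a X ∧ orderIso b T                 ∎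
    where open ≡-Reasoning
  ... | tri< a<X _ _ rewrite length≢⇒orderIso≡false a X (<⇒≢ a<X) | ++-assoc χ (m₁ ∷ []) T =
    cut-inside-ascent [] χ m₁ T χ<m₁ ab 1≤a (s≤s⁻¹ (subst (length a <_) (length-++-∷ʳ [] χ m₁) a<X))
  ... | tri> _ _ X<a rewrite length≢⇒orderIso≡false a X (≢-sym (<⇒≢ X<a)) =
    cut-before-final-max X θ m₂ θ<m₂ ab X<a 1≤b

  orderIso-[]-X++T : orderIso [] (X ++ T) ≡ false
  orderIso-[]-X++T = trans (cong (orderIso []) (++-assoc χ (m₁ ∷ []) T)) (orderIso-[]-∷ʳ χ m₁ T)

  𝟙-copy-++ : ∀ a b → Above a b →
    𝟙 (orderIso (a ++ b) (X ++ T)) ≡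
      𝟙 (orderIso a (X ++ T)) * 𝟙 (null b) + 𝟙 (null a) * 𝟙 (orderIso b (X ++ T)) + 𝟙 (orderIso a X) * 𝟙 (orderIso b T)
  𝟙-copy-++ [] b _ rewrite orderIso-[]-X++T | orderIso-[]-∷ʳ χ m₁ [] =
    sym (trans (+-identityʳ _) (+-identityʳ _))
  𝟙-copy-++ (x ∷ a) [] _ rewrite ++-identityʳ a | orderIso-[]-∷ʳ θ m₂ [] =
    sym (trans (cong₂ _+_ (+-identityʳ _) (*-zeroʳ (𝟙 (orderIso (x ∷ a) X))))
        (trans (+-identityʳ _) (*-identityʳ _)))
  𝟙-copy-++ (x ∷ a) (z ∷ b) ab rewrite copy-++ (x ∷ a) (z ∷ b) ab (s≤s z≤n) (s≤s z≤n) =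
    trans (𝟙-∧ (orderIso (x ∷ a) X) (orderIso (z ∷ b) T))
          (sym (cong (_+ 𝟙 (orderIso (x ∷ a) X) * 𝟙 (orderIso (z ∷ b) T))
                     (trans (+-identityʳ _) (*-zeroʳ (𝟙 (orderIso (x ∷ a) (X ++ T)))))))

  𝟙-copy-insert : ∀ N a b → Layered N a b →
    𝟙 (orderIso (a ++ N ∷ b) (X ++ T)) ≡ 𝟙 (orderIso a χ) * 𝟙 (orderIso b T)
  𝟙-copy-insert N a [] (_ , a<N , _)
    rewrite sym (++-assoc X θ (m₂ ∷ [])) | orderIso-[]-∷ʳ θ m₂ [] with orderIso (a ∷ʳ N) ((X ++ θ) ∷ʳ m₂) in e
  ... | true  = contradiction (All.lookup (All.lookup XT (∈-++⁺ʳ χ (here refl))) (∈-++⁺ʳ θ (here refl)))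
                  (<⇒≯ (All.lookup (copy-∷ʳ-top⇒final-max a (X ++ θ) N m₂ a<N e) (∈-++⁺ˡ (∈-++⁺ʳ χ (here refl)))))
  ... | false = sym (*-zeroʳ (𝟙 (orderIso a χ)))
  𝟙-copy-insert N a (z ∷ b) (ab , a<N , b<N)
    rewrite sym (++-assoc a (N ∷ []) (z ∷ b))
          | copy-++ (a ∷ʳ N) (z ∷ b) (All.++⁺ ab (b<N ∷ [])) (0<length-∷ʳ a N) (s≤s z≤n)
          | orderIso-∷ʳ-max a χ N m₁ a<N χ<m₁
    = 𝟙-∧ (orderIso a χ) (orderIso (z ∷ b) T)

occurrences : List ℕ → List ℕ → ℕ
occurrences σ p = ∑ (λ s → 𝟙 (orderIso s σ)) (subseqs p)

copies≡occurrences : ∀ σ p → copies σ p ≡ occurrences σ p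
copies≡occurrences σ p = length-filter (λ s → orderIso s σ) (subseqs p)

∑² : (List ℕ → List ℕ → ℕ) → List ℕ → List ℕ → ℕ
∑² h L R = ∑ (λ a → ∑ (h a) (subseqs R)) (subseqs L)

∑²-+ : ∀ g h L R → ∑² (λ a b → g a b + h a b) L R ≡ ∑² g L R + ∑² h L R
∑²-+ g h L R = trans (∑-cong (λ a → ∑-+ (g a) (h a) (subseqs R)) (subseqs L)) (∑-+ _ _ (subseqs L))

∑²-* : ∀ f g L R → ∑² (λ a b → f a * g b) L R ≡ ∑ f (subseqs L) * ∑ g (subseqs R)
∑²-* f g L R = trans (∑-cong (λ a → ∑-*ˡ (f a) g (subseqs R)) (subseqs L)) (∑-*ʳ _ f (subseqs L))

∑²-congᴸ : ∀ {N g h} L R → Layered N L R → (∀ a b → Layered N a b → g a b ≡ h a b) → ∑² g L R ≡ ∑² h L R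
∑²-congᴸ L R LNR e = ∑-congᴬ (All.map (λ {a} ab → ∑-congᴬ (All.map (λ {b} → e a b) ab)) (Layered-subseqs L R LNR))

occurrences-++ : ∀ σ L R → occurrences σ (L ++ R) ≡ ∑² (λ a b → 𝟙 (orderIso (a ++ b) σ)) L R
occurrences-++ σ = ∑-subseqs-++ (λ s → 𝟙 (orderIso s σ))

occurrences-insert : ∀ σ N L R → occurrences σ (L ++ N ∷ R) ≡
  ∑² (λ a b → 𝟙 (orderIso (a ++ N ∷ b) σ)) L R + ∑² (λ a b → 𝟙 (orderIso (a ++ b) σ)) L R
occurrences-insert σ N L R =
  trans (occurrences-++ σ L (N ∷ R))
  (trans (∑-cong (λ a → trans (∑-++ _ (map (N ∷_) (subseqs R)) (subseqs R))
                              (cong (_+ _) (∑-map (λ b → 𝟙 (orderIso (a ++ b) σ)) (N ∷_) (subseqs R))))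
                 (subseqs L))
         (∑-+ _ _ (subseqs L)))

-- A copy of τ m through N is a copy of τ in L followed by N; any other copy lies within L or within R.
occurrences-maxEnding-insert : ∀ {τ m N L R} → All (_< m) τ → Layered N L R →
  occurrences (τ ∷ʳ m) (L ++ N ∷ R) ≡ occurrences (τ ∷ʳ m) L + occurrences (τ ∷ʳ m) R + occurrences τ L
occurrences-maxEnding-insert {τ} {m} {N} {L} {R} τ<m LNR = begin
  occurrences σ (L ++ N ∷ R)
    ≡⟨ occurrences-insert σ N L R ⟩
  ∑² (λ a b → 𝟙 (orderIso (a ++ N ∷ b) σ)) L R + ∑² (λ a b → 𝟙 (orderIso (a ++ b) σ)) L R
    ≡⟨ cong₂ _+_ (∑²-congᴸ L R LNR (λ a b → 𝟙-copy-insert N a b))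
                 (∑²-congᴸ L R LNR (λ a b (ab , _) → 𝟙-copy-++ a b ab)) ⟩
  ∑² (λ a b → 𝟙 (orderIso a τ) * 𝟙 (null b)) L R
    + ∑² (λ a b → 𝟙 (orderIso a σ) * 𝟙 (null b) + 𝟙 (null a) * 𝟙 (orderIso b σ)) L R
    ≡⟨ cong (∑² _ L R +_) (∑²-+ _ _ L R) ⟩
  ∑² (λ a b → 𝟙 (orderIso a τ) * 𝟙 (null b)) L R
    + (∑² (λ a b → 𝟙 (orderIso a σ) * 𝟙 (null b)) L R + ∑² (λ a b → 𝟙 (null a) * 𝟙 (orderIso b σ)) L R)
    ≡⟨ cong₂ _+_ (∑²-* _ _ L R) (cong₂ _+_ (∑²-* _ _ L R) (∑²-* _ _ L R)) ⟩
  occurrences τ L * empties R + (occurrences σ L * empties R + empties L * occurrences σ R)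
    ≡⟨ cong₂ (λ r l → occurrences τ L * r + (occurrences σ L * r + l * occurrences σ R))
             (∑-null-subseqs R) (∑-null-subseqs L) ⟩
  occurrences τ L * 1 + (occurrences σ L * 1 + 1 * occurrences σ R)
    ≡⟨ rearrange (occurrences τ L) (occurrences σ L) (occurrences σ R) ⟩
  occurrences σ L + occurrences σ R + occurrences τ L ∎
  where
  open ≡-Reasoning
  open MaxEnding τ<m
  σ = τ ∷ʳ m
  empties : List ℕ → ℕ
  empties p = ∑ (λ s → 𝟙 (null s)) (subseqs p)
  rearrange : ∀ x y z → x * 1 + (y * 1 + 1 * z) ≡ y + z + x
  rearrange = solve-∀

-- A copy of X T through N uses N as the top of X, so it is a copy of χ in L followed by one of T in R;
-- any other copy lies within L, within R, or is a copy of X in L followed by one of T in R.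
occurrences-skew-insert : ∀ {χ m₁ θ m₂ N L R} → All (_< m₁) χ → All (_< m₂) θ →
  Above (χ ∷ʳ m₁) (θ ∷ʳ m₂) → Layered N L R →
  let X = χ ∷ʳ m₁; T = θ ∷ʳ m₂ in
  occurrences (X ++ T) (L ++ N ∷ R) ≡
    occurrences (X ++ T) L + occurrences (X ++ T) R + occurrences X L * occurrences T R + occurrences χ L * occurrences T R
occurrences-skew-insert {χ} {m₁} {θ} {m₂} {N} {L} {R} χ<m₁ θ<m₂ XT LNR = begin
  occurrences σ (L ++ N ∷ R)
    ≡⟨ occurrences-insert σ N L R ⟩
  ∑² (λ a b → 𝟙 (orderIso (a ++ N ∷ b) σ)) L R + ∑² (λ a b → 𝟙 (orderIso (a ++ b) σ)) L R
    ≡⟨ cong₂ _+_ (∑²-congᴸ L R LNR (λ a b → 𝟙-copy-insert N a b))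
                 (∑²-congᴸ L R LNR (λ a b (ab , _) → 𝟙-copy-++ a b ab)) ⟩
  ∑² (λ a b → 𝟙 (orderIso a χ) * 𝟙 (orderIso b T)) L R
    + ∑² (λ a b → 𝟙 (orderIso a σ) * 𝟙 (null b) + 𝟙 (null a) * 𝟙 (orderIso b σ)
                    + 𝟙 (orderIso a X) * 𝟙 (orderIso b T)) L R
    ≡⟨ cong (∑² _ L R +_) (trans (∑²-+ _ _ L R)
         (cong (_+ ∑² (λ a b → 𝟙 (orderIso a X) * 𝟙 (orderIso b T)) L R) (∑²-+ _ _ L R))) ⟩
  ∑² (λ a b → 𝟙 (orderIso a χ) * 𝟙 (orderIso b T)) L R
    + (∑² (λ a b → 𝟙 (orderIso a σ) * 𝟙 (null b)) L R + ∑² (λ a b → 𝟙 (null a) * 𝟙 (orderIso b σ)) L R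
       + ∑² (λ a b → 𝟙 (orderIso a X) * 𝟙 (orderIso b T)) L R)
    ≡⟨ cong₂ _+_ (∑²-* _ _ L R) (cong₂ _+_ (cong₂ _+_ (∑²-* _ _ L R) (∑²-* _ _ L R)) (∑²-* _ _ L R)) ⟩
  occurrences χ L * occurrences T R
    + (occurrences σ L * empties R + empties L * occurrences σ R + occurrences X L * occurrences T R)
    ≡⟨ cong₂ (λ r l → occurrences χ L * occurrences T R
                        + (occurrences σ L * r + l * occurrences σ R + occurrences X L * occurrences T R))
             (∑-null-subseqs R) (∑-null-subseqs L) ⟩
  occurrences χ L * occurrences T R
    + (occurrences σ L * 1 + 1 * occurrences σ R + occurrences X L * occurrences T R)
    ≡⟨ rearrange (occurrences χ L * occurrences T R) (occurrences σ L) (occurrences σ R) (occurrences X L * occurrences T R) ⟩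
  occurrences σ L + occurrences σ R + occurrences X L * occurrences T R + occurrences χ L * occurrences T R ∎
  where
  open ≡-Reasoning
  open Skew χ<m₁ θ<m₂ XT
  σ = X ++ T
  empties : List ℕ → ℕ
  empties p = ∑ (λ s → 𝟙 (null s)) (subseqs p)
  rearrange : ∀ c x y z → c + (x * 1 + 1 * y + z) ≡ x + y + z + c
  rearrange = solve-∀

-- 132-avoidance under insertion of a new maximum

p132 : List ℕ
p132 = 1 ∷ 3 ∷ 2 ∷ []

avoids132 : List ℕ → Bool
avoids132 = avoids p132

isZero : ℕ → Bool
isZero zero    = true
isZero (suc _) = false

isZero-+ : ∀ x y → isZero (x + y) ≡ isZero x ∧ isZero y
isZero-+ zero    y = refl
isZero-+ (suc x) y = refl

avoids≡isZero : ∀ r p → avoids r p ≡ isZero (occurrences r p)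
avoids≡isZero r p rewrite sym (copies≡occurrences r p) with copies r p
... | zero  = refl
... | suc _ = refl

allBelow? : List ℕ → ℕ → Bool
allBelow? []       x = true
allBelow? (z ∷ zs) x = (z <ᵇ x) ∧ allBelow? zs x

above? : List ℕ → List ℕ → Bool
above? []      R = true
above? (x ∷ L) R = allBelow? R x ∧ above? L R

allBelow?-sound : ∀ R x → allBelow? R x ≡ true → All (_< x) R
allBelow?-sound []      x e = []
allBelow?-sound (z ∷ R) x e = <ᵇ≡true⇒< (∧-true-left e) ∷ allBelow?-sound R x (∧-true-right {z <ᵇ x} e)

allBelow?-complete : ∀ {R x} → All (_< x) R → allBelow? R x ≡ true
allBelow?-complete []        = refl
allBelow?-complete (z<x ∷ h) rewrite <⇒<ᵇ≡true z<x = allBelow?-complete h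

above?-sound : ∀ L R → above? L R ≡ true → Above L R
above?-sound []      R e = []
above?-sound (x ∷ L) R e = allBelow?-sound R x (∧-true-left e) ∷ above?-sound L R (∧-true-right {allBelow? R x} e)

above?-complete : ∀ {L R} → Above L R → above? L R ≡ true
above?-complete []       = refl
above?-complete (h ∷ hs) rewrite allBelow?-complete h = above?-complete hs

-- N could only play the 3 of 132, and then the 1 taken from a would lie above the 2 taken from b.
no-132-through-top : ∀ N a b → Layered N a b → orderIso (a ++ N ∷ b) p132 ≡ false
no-132-through-top N []      []                  _ = refl
no-132-through-top N []      (z ∷ [])            _ = length≢⇒orderIso≡false (N ∷ z ∷ []) p132 λ ()
no-132-through-top N []      (z₁ ∷ z₂ ∷ [])      (_ , _ , z₁<N ∷ _) rewrite ≤⇒<ᵇ≡false (<⇒≤ z₁<N) = refl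
no-132-through-top N []      (z₁ ∷ z₂ ∷ z₃ ∷ b)  _ =
  length≢⇒orderIso≡false (N ∷ z₁ ∷ z₂ ∷ z₃ ∷ b) p132 λ ()
no-132-through-top N (x ∷ []) []                 _ = length≢⇒orderIso≡false (x ∷ N ∷ []) p132 λ ()
no-132-through-top N (x ∷ []) (z ∷ [])           ((z<x ∷ []) ∷ [] , x<N ∷ [] , _)
  rewrite <⇒<ᵇ≡true x<N | ≤⇒<ᵇ≡false (<⇒≤ x<N) | ≤⇒<ᵇ≡false (<⇒≤ z<x) = refl
no-132-through-top N (x ∷ []) (z₁ ∷ z₂ ∷ b)      _ = length≢⇒orderIso≡false (x ∷ N ∷ z₁ ∷ z₂ ∷ b) p132 λ ()
no-132-through-top N (x₁ ∷ x₂ ∷ []) []           (_ , _ ∷ x₂<N ∷ [] , _)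
  rewrite <⇒<ᵇ≡true x₂<N = ∧-zeroʳ (sameRel x₁ (x₂ ∷ N ∷ []) 1 (3 ∷ 2 ∷ []))
no-132-through-top N (x₁ ∷ x₂ ∷ []) (z ∷ b)      _ = length≢⇒orderIso≡false (x₁ ∷ x₂ ∷ N ∷ z ∷ b) p132 λ ()
no-132-through-top N (x₁ ∷ x₂ ∷ x₃ ∷ a) b        _ =
  length≢⇒orderIso≡false (x₁ ∷ x₂ ∷ x₃ ∷ a ++ N ∷ b) p132 λ e →
    0≢1+n (sym (suc-injective (suc-injective (suc-injective (trans (sym length≡) e)))))
  where
  length≡ : length (x₁ ∷ x₂ ∷ x₃ ∷ a ++ N ∷ b) ≡ 3 + suc (length a + length b)
  length≡ = cong (3 +_) (trans (length-++ a) (+-suc (length a) (length b)))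

Distinct : List ℕ → List ℕ → Set
Distinct L R = All (λ x → All (x ≢_) R) L

no-132-through-top⇒Above : ∀ N L R → Distinct L R → All (_< N) L → All (_< N) R →
  ∑² (λ a b → 𝟙 (orderIso (a ++ N ∷ b) p132)) L R ≡ 0 → Above L R
no-132-through-top⇒Above N L R LR L<N R<N none =
  All.tabulate λ x∈L → All.tabulate λ z∈R → below x∈L z∈R
  where
  below : ∀ {x z} → x ∈ L → z ∈ R → z < x
  below {x} {z} x∈L z∈R with <-cmp x z
  ... | tri> _ _ z<x = z<x
  ... | tri≈ _ x≡z _ = contradiction x≡z (All.lookup (All.lookup LR x∈L) z∈R)
  ... | tri< x<z _ _ = contradiction copy (one≢zero x<z (All.lookup L<N x∈L) (All.lookup R<N z∈R))
    where
    copy : 𝟙 (orderIso (x ∷ N ∷ z ∷ []) p132) ≡ 0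
    copy = All.lookup (∑-zero-at _ (subseqs R) (All.lookup (∑-zero-at _ (subseqs L) none) ([x]∈subseqs x∈L)))
                      ([x]∈subseqs z∈R)
    one≢zero : x < z → x < N → z < N → 𝟙 (orderIso (x ∷ N ∷ z ∷ []) p132) ≢ 0
    one≢zero x<z x<N z<N
      rewrite <⇒<ᵇ≡true x<N | ≤⇒<ᵇ≡false (<⇒≤ x<N) | <⇒<ᵇ≡true x<z | ≤⇒<ᵇ≡false (<⇒≤ x<z)
            | <⇒<ᵇ≡true z<N | ≤⇒<ᵇ≡false (<⇒≤ z<N) = λ ()

avoids132-insert : ∀ N L R → Distinct L R → All (_< N) L → All (_< N) R →
  avoids132 (L ++ N ∷ R) ≡ above? L R ∧ avoids132 (L ++ R)
avoids132-insert N L R LR L<N R<N = begin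
  avoids132 (L ++ N ∷ R)
    ≡⟨ avoids≡isZero p132 (L ++ N ∷ R) ⟩
  isZero (occurrences p132 (L ++ N ∷ R))
    ≡⟨ cong isZero (occurrences-insert p132 N L R) ⟩
  isZero (through + ∑² (λ a b → 𝟙 (orderIso (a ++ b) p132)) L R)
    ≡⟨ isZero-+ through _ ⟩
  isZero through ∧ isZero (∑² (λ a b → 𝟙 (orderIso (a ++ b) p132)) L R)
    ≡⟨ cong₂ _∧_ isZero-through (cong isZero (sym (occurrences-++ p132 L R))) ⟩
  above? L R ∧ isZero (occurrences p132 (L ++ R))
    ≡⟨ cong (above? L R ∧_) (sym (avoids≡isZero p132 (L ++ R))) ⟩
  above? L R ∧ avoids132 (L ++ R) ∎
  where
  open ≡-Reasoning
  through = ∑² (λ a b → 𝟙 (orderIso (a ++ N ∷ b) p132)) L R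
  isZero-through : isZero through ≡ above? L R
  isZero-through with above? L R in e
  ... | true  = cong isZero (∑-zero (All.map (λ h → ∑-zero (All.map (λ {b} lay → cong 𝟙 (no-132-through-top N _ b lay)) h))
                  (Layered-subseqs L R (above?-sound L R e , L<N , R<N))))
  ... | false with through in none
  ...   | suc _ = refl
  ...   | zero  = contradiction (trans (sym (above?-complete (no-132-through-top⇒Above N L R LR L<N R<N none))) e) λ ()

-- Decomposition of 132-avoiders

IsPermOf : ℕ → List ℕ → Set
IsPermOf n p = Unique p × All (λ x → 1 ≤ x × x ≤ n) p

Unique-++⇒Distinct : ∀ L R → Unique (L ++ R) → Distinct L R
Unique-++⇒Distinct []      R _          = []
Unique-++⇒Distinct (x ∷ L) R (x∉ ∷ LR) = All.++⁻ʳ L x∉ ∷ Unique-++⇒Distinct L R LR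

insertions-All : ∀ {P : ℕ → Set} x ys → P x → All P ys → All (All P) (insertions x ys)
insertions-All x []       px _         = (px ∷ []) ∷ []
insertions-All x (y ∷ ys) px (py ∷ h) = (px ∷ py ∷ h) ∷ All.map⁺ (All.map (py ∷_) (insertions-All x ys px h))

insertions-Unique : ∀ x ys → All (x ≢_) ys → Unique ys → All Unique (insertions x ys)
insertions-Unique x []       _          _          = ([] ∷ []) ∷ []
insertions-Unique x (y ∷ ys) (x≢y ∷ x∉) (y∉ ∷ uys) = ((x≢y ∷ x∉) ∷ y∉ ∷ uys) ∷
  All.map⁺ (All.zipWith (λ (y∉′ , u) → y∉′ ∷ u)
    (insertions-All {y ≢_} x ys (≢-sym x≢y) y∉ , insertions-Unique x ys x∉ uys))

perms-IsPermOf : ∀ n → All (IsPermOf n) (perms n)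
perms-IsPermOf zero    = ([] , []) ∷ []
perms-IsPermOf (suc n) = All.concat⁺ (All.map⁺ (All.map insert (perms-IsPermOf n)))
  where
  insert : ∀ {p} → IsPermOf n p → All (IsPermOf (suc n)) (insertions (suc n) p)
  insert {p} (u , bounds) = All.zipWith (λ (u′ , b′) → u′ , b′)
    (insertions-Unique (suc n) p (All.map (λ (_ , x≤n) e → <⇒≢ (s≤s x≤n) (sym e)) bounds) u ,
     insertions-All (suc n) p (s≤s z≤n , ≤-refl) (All.map (λ (1≤x , x≤n) → 1≤x , m≤n⇒m≤1+n x≤n) bounds))

splits : List ℕ → List (List ℕ × List ℕ)
splits []       = ([] , []) ∷ []
splits (x ∷ xs) = ([] , x ∷ xs) ∷ map (λ (L , R) → x ∷ L , R) (splits xs)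

splits-++ : ∀ p → All (λ (L , R) → L ++ R ≡ p) (splits p)
splits-++ []       = refl ∷ []
splits-++ (x ∷ xs) = refl ∷ All.map⁺ (All.map (cong (x ∷_)) (splits-++ xs))

insertions≡map-splits : ∀ N p → insertions N p ≡ map (λ (L , R) → L ++ N ∷ R) (splits p)
insertions≡map-splits N []       = refl
insertions≡map-splits N (x ∷ xs) = cong ((N ∷ x ∷ xs) ∷_)
  (trans (cong (map (x ∷_)) (insertions≡map-splits N xs)) (trans (sym (map-∘ (splits xs))) (map-∘ (splits xs))))

∑Av : ℕ → (List ℕ → ℕ) → ℕ
∑Av n f = ∑ (λ p → keepIf (avoids132 p) (f p)) (perms n)

∑Av-congᴾ : ∀ n {f g} → (∀ p → IsPermOf n p → f p ≡ g p) → ∑Av n f ≡ ∑Av n g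
∑Av-congᴾ n e = ∑-congᴬ (All.map (λ {p} hp → cong (keepIf (avoids132 p)) (e p hp)) (perms-IsPermOf n))

∑Av-cong : ∀ n {f g} → (∀ p → f p ≡ g p) → ∑Av n f ≡ ∑Av n g
∑Av-cong n e = ∑Av-congᴾ n (λ p _ → e p)

keepIf-+ : ∀ c x y → keepIf c (x + y) ≡ keepIf c x + keepIf c y
keepIf-+ true  x y = refl
keepIf-+ false x y = refl

keepIf-*ʳ : ∀ c x k → keepIf c (x * k) ≡ keepIf c x * k
keepIf-*ʳ true  x k = refl
keepIf-*ʳ false x k = refl

keepIf-∧ : ∀ s v x → keepIf (s ∧ v) x ≡ keepIf v (keepIf s x)
keepIf-∧ true  v     x = refl
keepIf-∧ false true  x = refl
keepIf-∧ false false x = refl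

∑Av-+ : ∀ n f g → ∑Av n (λ p → f p + g p) ≡ ∑Av n f + ∑Av n g
∑Av-+ n f g = trans (∑-cong (λ p → keepIf-+ (avoids132 p) (f p) (g p)) (perms n)) (∑-+ _ _ (perms n))

∑Av-*ʳ : ∀ n f k → ∑Av n (λ p → f p * k) ≡ ∑Av n f * k
∑Av-*ʳ n f k = trans (∑-cong (λ p → keepIf-*ʳ (avoids132 p) (f p) k) (perms n)) (∑-*ʳ k _ (perms n))

∑Av-*ˡ : ∀ n f k → ∑Av n (λ p → k * f p) ≡ k * ∑Av n f
∑Av-*ˡ n f k = trans (∑Av-cong n (λ p → *-comm k (f p))) (trans (∑Av-*ʳ n f k) (*-comm _ k))

∑Av² : ℕ → ℕ → (List ℕ → List ℕ → ℕ) → ℕ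
∑Av² a b h = ∑Av a (λ L → ∑Av b (h L))

∑Av²-+ : ∀ a b g h → ∑Av² a b (λ L R → g L R + h L R) ≡ ∑Av² a b g + ∑Av² a b h
∑Av²-+ a b g h = trans (∑Av-cong a (λ L → ∑Av-+ b (g L) (h L))) (∑Av-+ a _ _)

∑Av²-* : ∀ a b (f g : List ℕ → ℕ) → ∑Av² a b (λ L R → f L * g R) ≡ ∑Av a f * ∑Av b g
∑Av²-* a b f g = trans (∑Av-cong a (λ L → ∑Av-*ˡ b g (f L))) (∑Av-*ʳ a f (∑Av b g))

∑Above : List ℕ → List ℕ → (List ℕ → List ℕ → ℕ) → ℕ
∑Above c p h = ∑ (λ (L , R) → keepIf (above? (c ++ L) R) (h L R)) (splits p)

∑Above-∷ : ∀ c x xs h →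
  ∑Above c (x ∷ xs) h ≡ keepIf (above? c (x ∷ xs)) (h [] (x ∷ xs)) + ∑Above (c ∷ʳ x) xs (λ L R → h (x ∷ L) R)
∑Above-∷ c x xs h = cong₂ _+_
  (cong (λ c′ → keepIf (above? c′ (x ∷ xs)) (h [] (x ∷ xs))) (++-identityʳ c))
  (trans (∑-map _ _ (splits xs))
         (∑-cong (λ (L , R) → cong (λ c′ → keepIf (above? c′ R) (h (x ∷ L) R)) (sym (++-assoc c (x ∷ []) L)))
                 (splits xs)))

above?-++ : ∀ c X Y → above? (c ++ X) Y ≡ above? c Y ∧ above? X Y
above?-++ []      X Y = refl
above?-++ (x ∷ c) X Y rewrite above?-++ c X Y = sym (∧-assoc (allBelow? Y x) (above? c Y) (above? X Y))

allBelow?-false : ∀ {N c Q} → c < N → N ∈ Q → allBelow? Q c ≡ false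
allBelow?-false {Q = _ ∷ Q} c<N (here refl) rewrite ≤⇒<ᵇ≡false (<⇒≤ c<N) = refl
allBelow?-false {Q = z ∷ Q} c<N (there N∈Q) rewrite allBelow?-false {Q = Q} c<N N∈Q = ∧-zeroʳ _

∑Above-prefix : ∀ c R h → Above c R → ∑Above c R h ≡ ∑Above [] R h
∑Above-prefix c R h cR = ∑-congᴬ (All.map dropPrefix (splits-++ R))
  where
  dropPrefix : ∀ {XY} → proj₁ XY ++ proj₂ XY ≡ R →
    let (X , Y) = XY in keepIf (above? (c ++ X) Y) (h X Y) ≡ keepIf (above? X Y) (h X Y)
  dropPrefix {X , Y} refl rewrite above?-++ c X Y | above?-complete (All.map (All.++⁻ʳ X) cR) = refl

-- Once the prefix contains an entry below N, no split with N on the right counts.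
∑Above-past-top : ∀ c₀ c N L R h → c₀ < N →
  ∑Above (c₀ ∷ c) (L ++ N ∷ R) h ≡ ∑Above ((c₀ ∷ c) ++ L ∷ʳ N) R (λ X Y → h (L ++ N ∷ X) Y)
∑Above-past-top c₀ c N [] R h c₀<N rewrite ∑Above-∷ (c₀ ∷ c) N R h | allBelow?-false {Q = N ∷ R} c₀<N (here refl) = refl
∑Above-past-top c₀ c N (y ∷ L) R h c₀<N
  rewrite ∑Above-∷ (c₀ ∷ c) y (L ++ N ∷ R) h
        | allBelow?-false {Q = y ∷ L ++ N ∷ R} c₀<N (there (∈-++⁺ʳ L (here refl)))
  = trans (∑Above-past-top c₀ (c ∷ʳ y) N L R (λ X Y → h (y ∷ X) Y) c₀<N)
          (cong (λ c′ → ∑Above (c₀ ∷ c′) R (λ X Y → h (y ∷ L ++ N ∷ X) Y)) (++-assoc c (y ∷ []) (L ∷ʳ N)))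

∑Above-insert : ∀ L N R g → Layered N L R →
  ∑Above [] (L ++ N ∷ R) g ≡ g [] (L ++ N ∷ R) + ∑Above [] R (λ X Y → g (L ++ N ∷ X) Y)
∑Above-insert [] N R g (_ , _ , R<N) rewrite ∑Above-∷ [] N R g =
  cong (g [] (N ∷ R) +_) (∑Above-prefix (N ∷ []) R _ (R<N ∷ []))
∑Above-insert (x ∷ L) N R g (LR , x<N ∷ _ , R<N) rewrite ∑Above-∷ [] x (L ++ N ∷ R) g =
  cong (g [] (x ∷ L ++ N ∷ R) +_) (trans (∑Above-past-top x [] N L R (λ X Y → g (x ∷ X) Y) x<N)
    (∑Above-prefix (x ∷ L ∷ʳ N) R _ (All.++⁺ LR (R<N ∷ []))))

-- perms (suc n) inserts n + 1 into each p of length n, and L (n + 1) R avoids 132 iff L ++ R does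
-- and L lies above R.
∑Av-suc : ∀ n f → ∑Av (suc n) f ≡ ∑Av n (λ p → ∑Above [] p (λ L R → f (L ++ suc n ∷ R)))
∑Av-suc n f = trans (∑-concatMap _ (insertions (suc n)) (perms n))
  (∑-congᴬ (All.map (λ {p} hp → insertSum p hp) (perms-IsPermOf n)))
  where
  N = suc n
  insertSum : ∀ p → IsPermOf n p →
    ∑ (λ q → keepIf (avoids132 q) (f q)) (insertions N p) ≡ keepIf (avoids132 p) (∑Above [] p (λ L R → f (L ++ N ∷ R)))
  insertSum p (u , bounds) = begin
    ∑ (λ q → keepIf (avoids132 q) (f q)) (insertions N p)
      ≡⟨ cong (∑ _) (insertions≡map-splits N p) ⟩
    ∑ _ (map (λ (L , R) → L ++ N ∷ R) (splits p))
      ≡⟨ ∑-map _ _ (splits p) ⟩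
    ∑ (λ (L , R) → keepIf (avoids132 (L ++ N ∷ R)) (f (L ++ N ∷ R))) (splits p)
      ≡⟨ ∑-congᴬ (All.map atSplit (splits-++ p)) ⟩
    ∑ (λ (L , R) → keepIf (avoids132 p) (keepIf (above? L R) (f (L ++ N ∷ R)))) (splits p)
      ≡⟨ ∑-keepIf (avoids132 p) _ (splits p) ⟩
    keepIf (avoids132 p) (∑Above [] p (λ L R → f (L ++ N ∷ R))) ∎
    where
    open ≡-Reasoning
    atSplit : ∀ {LR} → proj₁ LR ++ proj₂ LR ≡ p →
      keepIf (avoids132 (proj₁ LR ++ N ∷ proj₂ LR)) (f (proj₁ LR ++ N ∷ proj₂ LR)) ≡
      keepIf (avoids132 p) (keepIf (above? (proj₁ LR) (proj₂ LR)) (f (proj₁ LR ++ N ∷ proj₂ LR)))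
    atSplit {L , R} refl with All.++⁻ L (All.map (λ (_ , x≤n) → s≤s x≤n) bounds)
    ... | L<N , R<N = trans (cong (λ c → keepIf c (f (L ++ N ∷ R))) (avoids132-insert N L R (Unique-++⇒Distinct L R u) L<N R<N))
                            (keepIf-∧ (above? L R) (avoids132 (L ++ R)) (f (L ++ N ∷ R)))

∑pairs : ℕ → (ℕ → ℕ → ℕ) → ℕ
∑pairs zero    F = F 0 0
∑pairs (suc n) F = F 0 (suc n) + ∑pairs n (λ a b → F (suc a) b)

∑pairs-cong : ∀ n {F G : ℕ → ℕ → ℕ} → (∀ a b → a + b ≡ n → F a b ≡ G a b) → ∑pairs n F ≡ ∑pairs n G
∑pairs-cong zero    e = e 0 0 refl
∑pairs-cong (suc n) e = cong₂ _+_ (e 0 (suc n) refl) (∑pairs-cong n (λ a b a+b≡n → e (suc a) b (cong suc a+b≡n)))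

∑pairs-+ : ∀ n (F G : ℕ → ℕ → ℕ) → ∑pairs n (λ a b → F a b + G a b) ≡ ∑pairs n F + ∑pairs n G
∑pairs-+ zero    F G = refl
∑pairs-+ (suc n) F G rewrite ∑pairs-+ n (λ a b → F (suc a) b) (λ a b → G (suc a) b) =
  interchange (F 0 (suc n)) (G 0 (suc n)) _ _
  where
  interchange : ∀ a b c d → a + b + (c + d) ≡ a + c + (b + d)
  interchange = solve-∀

∑pairs-assoc : ∀ n (F : ℕ → ℕ → ℕ → ℕ) →
  ∑pairs n (λ a b → ∑pairs b (λ c d → F a c d)) ≡ ∑pairs n (λ e d → ∑pairs e (λ a c → F a c d))
∑pairs-assoc zero    F = refl
∑pairs-assoc (suc n) F
  rewrite ∑pairs-+ n (λ e d → F 0 (suc e) d) (λ e d → ∑pairs e (λ a c → F (suc a) c d))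
        | ∑pairs-assoc n (λ a c d → F (suc a) c d) = +-assoc (F 0 0 (suc n)) _ _

∑Av-∑pairs : ∀ a b (F : List ℕ → ℕ → ℕ → ℕ) →
  ∑Av a (λ L → ∑pairs b (λ c d → F L c d)) ≡ ∑pairs b (λ c d → ∑Av a (λ L → F L c d))
∑Av-∑pairs a zero    F = refl
∑Av-∑pairs a (suc b) F = trans (∑Av-+ a (λ L → F L 0 (suc b)) (λ L → ∑pairs b (λ c d → F L (suc c) d)))
  (cong (∑Av a (λ L → F L 0 (suc b)) +_) (∑Av-∑pairs a b (λ L c d → F L (suc c) d)))

shift : ℕ → List ℕ → List ℕ
shift b = map (_+ b)

shift-shift : ∀ c d L → shift d (shift c L) ≡ shift (c + d) L
shift-shift c d L = trans (sym (map-∘ L)) (map-cong (λ x → +-assoc x c d) L)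

Layered-shift : ∀ a b n L R → a + b ≡ n → IsPermOf a L → IsPermOf b R → Layered (suc n) (shift b L) R
Layered-shift a b n L R a+b≡n (_ , L-bounds) (_ , R-bounds) =
  All.map⁺ (All.map (λ (1≤x , _) → All.map (λ (_ , z≤b) → ≤-trans (s≤s z≤b) (+-monoˡ-≤ b 1≤x)) R-bounds) L-bounds) ,
  All.map⁺ (All.map (λ (_ , x≤a) → s≤s (subst (_ + b ≤_) a+b≡n (+-monoˡ-≤ b x≤a))) L-bounds) ,
  All.map (λ (_ , z≤b) → s≤s (≤-trans z≤b (subst (b ≤_) a+b≡n (m≤n+m b a)))) R-bounds

-- A 132-avoider of length n + 1 is L (n + 1) R with R an avoider of length b and L an avoider
-- of length a shifted above it, for a unique split a + b = n.
Decomposition : ℕ → Set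
Decomposition n = ∀ f → ∑Av (suc n) f ≡ ∑pairs n (λ a b → ∑Av² a b (λ L R → f (shift b L ++ suc n ∷ R)))

AboveSplitting : ℕ → Set
AboveSplitting m = ∀ g → ∑Av m (λ p → ∑Above [] p g) ≡ ∑pairs m (λ a b → ∑Av² a b (λ L R → g (shift b L) R))

decomposition-from : ∀ n → AboveSplitting n → Decomposition n
decomposition-from n split f = trans (∑Av-suc n f) (split (λ L R → f (L ++ suc n ∷ R)))

shift-insert : ∀ c d e n L X → e + d ≡ n → shift d (shift c L ++ suc e ∷ X) ≡ shift (c + d) L ++ suc n ∷ shift d X
shift-insert c d e n L X e+d≡n = trans (map-++ (_+ d) (shift c L) (suc e ∷ X))
  (cong₂ _++_ (shift-shift c d L) (cong (λ k → suc k ∷ shift d X) e+d≡n))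

-- The above-splits X | Y of the part R right of n + 1 turn (L , R) into the pair (L (n + 1) X , Y),
-- where L (n + 1) X is again a shifted avoider: it is counted by ∑Av (suc a) once regrouped.
aboveSplitting-right : ∀ n → (∀ {k} → k < suc n → AboveSplitting k) → (g : List ℕ → List ℕ → ℕ) →
  ∑pairs n (λ a b → ∑Av² a b (λ L R → ∑Above [] R (λ X Y → g (shift b L ++ suc n ∷ X) Y)))
  ≡ ∑pairs n (λ a b → ∑Av² (suc a) b (λ L R → g (shift b L) R))
aboveSplitting-right n ih g = begin
  ∑pairs n (λ a b → ∑Av a (λ L → ∑Av b (λ R → ∑Above [] R (λ X Y → g (shift b L ++ N ∷ X) Y))))
    ≡⟨ ∑pairs-cong n (λ a b a+b≡n → ∑Av-cong a (λ L →
         ih (s≤s (subst (b ≤_) a+b≡n (m≤n+m b a))) (λ X Y → g (shift b L ++ N ∷ X) Y))) ⟩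
  ∑pairs n (λ a b → ∑Av a (λ L → ∑pairs b (λ c d →
    ∑Av c (λ X → ∑Av d (λ Y → g (shift b L ++ N ∷ shift d X) Y)))))
    ≡⟨ ∑pairs-cong n (λ a b _ → trans (∑Av-∑pairs a b _) (∑pairs-cong b (λ c d c+d≡b →
         ∑Av-cong a (λ L → ∑Av-cong c (λ X → ∑Av-cong d (λ Y →
           cong (λ k → g (shift k L ++ N ∷ shift d X) Y) (sym c+d≡b))))))) ⟩
  ∑pairs n (λ a b → ∑pairs b (λ c d → F a c d))
    ≡⟨ ∑pairs-assoc n F ⟩
  ∑pairs n (λ e d → ∑pairs e (λ a c → F a c d))
    ≡⟨ ∑pairs-cong n (λ e d e+d≡n → sym (trans
         (decomposition-from e (ih (s≤s (subst (e ≤_) e+d≡n (m≤m+n e d)))) (λ M → ∑Av d (λ Y → g (shift d M) Y)))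
         (∑pairs-cong e (λ a c _ → ∑Av-cong a (λ L → ∑Av-cong c (λ X → ∑Av-cong d (λ Y →
           cong (λ M → g M Y) (shift-insert c d e n L X e+d≡n)))))))) ⟩
  ∑pairs n (λ a b → ∑Av (suc a) (λ L → ∑Av b (λ R → g (shift b L) R))) ∎
  where
  open ≡-Reasoning
  N = suc n
  F : ℕ → ℕ → ℕ → ℕ
  F a c d = ∑Av a (λ L → ∑Av c (λ X → ∑Av d (λ Y → g (shift (c + d) L ++ N ∷ shift d X) Y)))

aboveSplitting : ∀ m → AboveSplitting m
aboveSplitting = <-rec AboveSplitting step
  where
  step : ∀ m → (∀ {k} → k < m → AboveSplitting k) → AboveSplitting m
  step zero    _  g = refl
  step (suc n) ih g = begin
    ∑Av N (λ p → ∑Above [] p g)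
      ≡⟨ decomposition (λ p → ∑Above [] p g) ⟩
    ∑pairs n (λ a b → ∑Av a (λ L → ∑Av b (λ R → ∑Above [] (shift b L ++ N ∷ R) g)))
      ≡⟨ ∑pairs-cong n (λ a b a+b≡n → ∑Av-congᴾ a (λ L hL → ∑Av-congᴾ b (λ R hR →
           ∑Above-insert (shift b L) N R g (Layered-shift a b n L R a+b≡n hL hR)))) ⟩
    ∑pairs n (λ a b → ∑Av a (λ L → ∑Av b (λ R → g [] (shift b L ++ N ∷ R) + rest b L R)))
      ≡⟨ trans (∑pairs-cong n (λ a b _ → ∑Av²-+ a b _ _)) (∑pairs-+ n _ _) ⟩
    ∑pairs n (λ a b → ∑Av a (λ L → ∑Av b (λ R → g [] (shift b L ++ N ∷ R))))
      + ∑pairs n (λ a b → ∑Av a (λ L → ∑Av b (rest b L)))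
      ≡⟨ cong₂ _+_ (sym (decomposition (g []))) (aboveSplitting-right n ih g) ⟩
    ∑Av N (g []) + ∑pairs n (λ a b → ∑Av (suc a) (λ L → ∑Av b (λ R → g (shift b L) R)))
      ≡⟨ cong (_+ ∑pairs n (λ a b → ∑Av (suc a) (λ L → ∑Av b (λ R → g (shift b L) R))))
              (sym (+-identityʳ (∑Av N (g [])))) ⟩
    ∑pairs N (λ a b → ∑Av a (λ L → ∑Av b (λ R → g (shift b L) R))) ∎
    where
    open ≡-Reasoning
    N = suc n
    decomposition : Decomposition n
    decomposition = decomposition-from n (ih ≤-refl)
    rest : ℕ → List ℕ → List ℕ → ℕ
    rest b L R = ∑Above [] R (λ X Y → g (shift b L ++ N ∷ X) Y)

decomposition : ∀ n → Decomposition n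
decomposition n = decomposition-from n (aboveSplitting n)

-- Generating functions

-- Sequences stand for generating functions: ⋆ is their product and x· multiplication by x.
Seq : Set
Seq = ℕ → ℕ

infix 4 _≈_
_≈_ : Seq → Seq → Set
u ≈ w = ∀ n → u n ≡ w n

≈-sym : ∀ {u w} → u ≈ w → w ≈ u
≈-sym e n = sym (e n)

≈-trans : ∀ {u v w} → u ≈ v → v ≈ w → u ≈ w
≈-trans e f n = trans (e n) (f n)

infixl 6 _⊞_
_⊞_ : Seq → Seq → Seq
(u ⊞ w) n = u n + w n

infixl 7 _⋆_
_⋆_ : Seq → Seq → Seq
(u ⋆ w) n = ∑pairs n (λ a b → u a * w b)

x· : Seq → Seq
x· u zero    = 0
x· u (suc n) = u n

∑pairs-last : ∀ n (F : ℕ → ℕ → ℕ) → ∑pairs (suc n) F ≡ ∑pairs n (λ a b → F a (suc b)) + F (suc n) 0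
∑pairs-last zero    F = refl
∑pairs-last (suc n) F rewrite ∑pairs-last n (λ a b → F (suc a) b) = sym (+-assoc (F 0 (suc (suc n))) _ _)

∑pairs-swap : ∀ n (F : ℕ → ℕ → ℕ) → ∑pairs n F ≡ ∑pairs n (λ a b → F b a)
∑pairs-swap zero    F = refl
∑pairs-swap (suc n) F rewrite ∑pairs-last n (λ a b → F b a) | ∑pairs-swap n (λ a b → F (suc a) b) =
  +-comm (F 0 (suc n)) _

∑pairs-*ˡ : ∀ n k (F : ℕ → ℕ → ℕ) → k * ∑pairs n F ≡ ∑pairs n (λ a b → k * F a b)
∑pairs-*ˡ zero    k F = refl
∑pairs-*ˡ (suc n) k F rewrite *-distribˡ-+ k (F 0 (suc n)) (∑pairs n (λ a b → F (suc a) b))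
                            | ∑pairs-*ˡ n k (λ a b → F (suc a) b) = refl

∑pairs-*ʳ : ∀ n k (F : ℕ → ℕ → ℕ) → ∑pairs n F * k ≡ ∑pairs n (λ a b → F a b * k)
∑pairs-*ʳ n k F = trans (*-comm (∑pairs n F) k) (trans (∑pairs-*ˡ n k F) (∑pairs-cong n (λ a b _ → *-comm k (F a b))))

⋆-cong : ∀ {u u′ w w′} → u ≈ u′ → w ≈ w′ → u ⋆ w ≈ u′ ⋆ w′
⋆-cong e f n = ∑pairs-cong n (λ a b _ → cong₂ _*_ (e a) (f b))

⋆-comm : ∀ u w → u ⋆ w ≈ w ⋆ u
⋆-comm u w n = trans (∑pairs-swap n (λ a b → u a * w b)) (∑pairs-cong n (λ a b _ → *-comm (u b) (w a)))

⋆-assoc : ∀ u w z → u ⋆ w ⋆ z ≈ u ⋆ (w ⋆ z)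
⋆-assoc u w z n =
  trans (∑pairs-cong n (λ e d _ → ∑pairs-*ʳ e (z d) (λ a c → u a * w c)))
  (trans (sym (∑pairs-assoc n (λ a c d → u a * w c * z d)))
  (∑pairs-cong n (λ a b _ → trans (∑pairs-cong b (λ c d _ → *-assoc (u a) (w c) (z d)))
                                  (sym (∑pairs-*ˡ b (u a) (λ c d → w c * z d))))))

⋆-distribˡ-⊞ : ∀ u w w′ → u ⋆ (w ⊞ w′) ≈ u ⋆ w ⊞ u ⋆ w′
⋆-distribˡ-⊞ u w w′ n = trans (∑pairs-cong n (λ a b _ → *-distribˡ-+ (u a) (w b) (w′ b))) (∑pairs-+ n _ _)

⋆-distribʳ-⊞ : ∀ u u′ w → (u ⊞ u′) ⋆ w ≈ u ⋆ w ⊞ u′ ⋆ w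
⋆-distribʳ-⊞ u u′ w n = trans (∑pairs-cong n (λ a b _ → *-distribʳ-+ (w b) (u a) (u′ a))) (∑pairs-+ n _ _)

x·-⋆ : ∀ u w → x· u ⋆ w ≈ x· (u ⋆ w)
x·-⋆ u w zero    = refl
x·-⋆ u w (suc n) = refl

x·-cong : ∀ {u w} → u ≈ w → x· u ≈ x· w
x·-cong e zero    = refl
x·-cong e (suc n) = e n

x·-⊞ : ∀ u w → x· (u ⊞ w) ≈ x· u ⊞ x· w
x·-⊞ u w zero    = refl
x·-⊞ u w (suc n) = refl

x⋆ : Seq → Seq → Seq
x⋆ Z u = x· (Z ⋆ u)

x⋆-cong : ∀ Z {u w} → u ≈ w → x⋆ Z u ≈ x⋆ Z w
x⋆-cong Z e = x·-cong (⋆-cong {Z} (λ _ → refl) e)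

x⋆-⊞ : ∀ Z u w → x⋆ Z (u ⊞ w) ≈ x⋆ Z u ⊞ x⋆ Z w
x⋆-⊞ Z u w = ≈-trans (x·-cong (⋆-distribˡ-⊞ Z u w)) (x·-⊞ _ _)

x⋆-comm : ∀ Z W u → x⋆ Z (x⋆ W u) ≈ x⋆ W (x⋆ Z u)
x⋆-comm Z W u =
  ≈-trans (x·-cong (≈-trans (⋆-comm Z (x⋆ W u)) (x·-⋆ (W ⋆ u) Z)))
  (≈-trans (x·-cong (x·-cong swapped))
           (≈-sym (x·-cong (≈-trans (⋆-comm W (x⋆ Z u)) (x·-⋆ (Z ⋆ u) W)))))
  where
  swapped : W ⋆ u ⋆ Z ≈ Z ⋆ u ⋆ W
  swapped = ≈-trans (⋆-assoc W u Z) (≈-trans (⋆-cong {W} (λ _ → refl) (⋆-comm u Z)) (⋆-comm W (Z ⋆ u)))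

-- Solutions of G = 2 x C G + H, i.e. G = H / (1 - 2 x C) as generating functions.
module Recurrence (C : Seq) where

  K : Seq → Seq
  K = x⋆ C

  Solves : Seq → Seq → Set
  Solves G H = ∀ n → G n ≡ K G n + K G n + H n

  K-local : ∀ {G G′} n → (∀ m → m < n → G m ≡ G′ m) → K G n ≡ K G′ n
  K-local zero    _ = refl
  K-local (suc n) e = ∑pairs-cong n (λ a b a+b≡n → cong (C a *_) (e b (s≤s (subst (b ≤_) a+b≡n (m≤n+m b a)))))

  -- K G n only looks at G below n, so the recurrence determines G from H by strong induction.
  solution-unique : ∀ {G G′ H H′} → Solves G H → Solves G′ H′ → H ≈ H′ → G ≈ G′
  solution-unique {G} {G′} {H} {H′} sG sG′ H≈H′ = go
    where
    go : G ≈ G′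
    go = <-rec (λ n → G n ≡ G′ n) λ n ih →
      trans (sG n) (trans (cong₂ _+_ (cong₂ _+_ (K-local n λ m m<n → ih m<n) (K-local n λ m m<n → ih m<n)) (H≈H′ n))
                          (sym (sG′ n)))

  Solves-resp : ∀ {G G′ H H′} → Solves G H → G ≈ G′ → H ≈ H′ → Solves G′ H′
  Solves-resp {G} {G′} sG G≈G′ H≈H′ n =
    trans (sym (G≈G′ n)) (trans (sG n) (cong₂ _+_ (cong₂ _+_ (x⋆-cong C G≈G′ n) (x⋆-cong C G≈G′ n)) (H≈H′ n)))

  Solves-⊞ : ∀ {G G′ H H′} → Solves G H → Solves G′ H′ → Solves (G ⊞ G′) (H ⊞ H′)
  Solves-⊞ {G} {G′} {H} {H′} sG sG′ n =
    trans (cong₂ _+_ (sG n) (sG′ n))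
      (trans (rearrange (K G n) (K G′ n) (H n) (H′ n)) (cong (λ k → k + k + (H n + H′ n)) (sym (x⋆-⊞ C G G′ n))))
    where
    rearrange : ∀ a b c d → a + a + c + (b + b + d) ≡ a + b + (a + b) + (c + d)
    rearrange = solve-∀

  Solves-x⋆ : ∀ Z {G H} → Solves G H → Solves (x⋆ Z G) (x⋆ Z H)
  Solves-x⋆ Z {G} {H} sG n =
    trans (x⋆-cong Z sG n)
    (trans (x⋆-⊞ Z (K G ⊞ K G) H n)
    (cong (_+ x⋆ Z H n) (trans (x⋆-⊞ Z (K G) (K G) n) (cong₂ _+_ (x⋆-comm Z C G n) (x⋆-comm Z C G n)))))

<ᵇ-+ : ∀ x z b → (x + b <ᵇ z + b) ≡ (x <ᵇ z)
<ᵇ-+ x z zero    rewrite +-identityʳ x | +-identityʳ z = refl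
<ᵇ-+ x z (suc b) rewrite +-suc x b | +-suc z b = <ᵇ-+ x z b

sameRel-shiftˡ : ∀ x y b s σ → sameRel (x + b) (map (_+ b) s) y σ ≡ sameRel x s y σ
sameRel-shiftˡ x y b []      []      = refl
sameRel-shiftˡ x y b []      (_ ∷ _) = refl
sameRel-shiftˡ x y b (_ ∷ _) []      = refl
sameRel-shiftˡ x y b (z ∷ s) (r ∷ σ) rewrite <ᵇ-+ x z b | <ᵇ-+ z x b | sameRel-shiftˡ x y b s σ = refl

sameRel-shiftʳ : ∀ x y b s σ → sameRel x s (y + b) (map (_+ b) σ) ≡ sameRel x s y σ
sameRel-shiftʳ x y b []      []      = refl
sameRel-shiftʳ x y b []      (_ ∷ _) = refl
sameRel-shiftʳ x y b (_ ∷ _) []      = refl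
sameRel-shiftʳ x y b (z ∷ s) (r ∷ σ) rewrite <ᵇ-+ y r b | <ᵇ-+ r y b | sameRel-shiftʳ x y b s σ = refl

orderIso-shiftˡ : ∀ s σ b → orderIso (map (_+ b) s) σ ≡ orderIso s σ
orderIso-shiftˡ []      []      b = refl
orderIso-shiftˡ []      (_ ∷ _) b = refl
orderIso-shiftˡ (_ ∷ _) []      b = refl
orderIso-shiftˡ (x ∷ s) (y ∷ σ) b rewrite sameRel-shiftˡ x y b s σ | orderIso-shiftˡ s σ b = refl

orderIso-shiftʳ : ∀ s σ b → orderIso s (map (_+ b) σ) ≡ orderIso s σ
orderIso-shiftʳ []      []      b = refl
orderIso-shiftʳ []      (_ ∷ _) b = refl
orderIso-shiftʳ (_ ∷ _) []      b = refl
orderIso-shiftʳ (x ∷ s) (y ∷ σ) b rewrite sameRel-shiftʳ x y b s σ | orderIso-shiftʳ s σ b = refl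

occurrences-shift-text : ∀ σ b p → occurrences σ (shift b p) ≡ occurrences σ p
occurrences-shift-text σ b p = trans (∑-subseqs-map (λ s → 𝟙 (orderIso s σ)) (_+ b) p)
  (∑-cong (λ s → cong 𝟙 (orderIso-shiftˡ s σ b)) (subseqs p))

occurrences-shift-pattern : ∀ σ b p → occurrences (shift b σ) p ≡ occurrences σ p
occurrences-shift-pattern σ b p = ∑-cong (λ s → cong 𝟙 (orderIso-shiftʳ s σ b)) (subseqs p)

F : List ℕ → Seq
F σ n = ∑Av n (occurrences σ)

catalan : Seq
catalan n = ∑Av n (λ _ → 1)

S≡F : ∀ n σ → S n p132 σ ≡ F σ n
S≡F n σ = trans (∑-filter avoids132 (copies σ) (perms n))
  (∑-cong (λ p → cong (keepIf (avoids132 p)) (copies≡occurrences σ p)) (perms n))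

F-cong : ∀ {σ σ′} → σ ≡ σ′ → F σ ≈ F σ′
F-cong refl n = refl

F-shift : ∀ σ b → F (shift b σ) ≈ F σ
F-shift σ b n = ∑Av-cong n (occurrences-shift-pattern σ b)

open Recurrence catalan

F-zero : ∀ σ → orderIso [] σ ≡ false → F σ 0 ≡ 0
F-zero σ e rewrite e = refl

occurrences-maxEnding-split : ∀ {τ m a b n L R} → All (_< m) τ → a + b ≡ n → IsPermOf a L → IsPermOf b R →
  occurrences (τ ∷ʳ m) (shift b L ++ suc n ∷ R) ≡ occurrences (τ ∷ʳ m) L + occurrences (τ ∷ʳ m) R + occurrences τ L
occurrences-maxEnding-split {τ} {m} {a} {b} {n} {L} {R} τ<m a+b≡n hL hR =
  trans (occurrences-maxEnding-insert τ<m (Layered-shift a b n L R a+b≡n hL hR))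
        (cong₂ (λ x y → x + occurrences (τ ∷ʳ m) R + y)
               (occurrences-shift-text (τ ∷ʳ m) b L) (occurrences-shift-text τ b L))

occurrences-skew-split : ∀ {χ m₁ θ m₂ a b n L R} → All (_< m₁) χ → All (_< m₂) θ →
  Above (χ ∷ʳ m₁) (θ ∷ʳ m₂) → a + b ≡ n → IsPermOf a L → IsPermOf b R →
  let X = χ ∷ʳ m₁; T = θ ∷ʳ m₂ in
  occurrences (X ++ T) (shift b L ++ suc n ∷ R) ≡
    occurrences (X ++ T) L + occurrences (X ++ T) R + occurrences X L * occurrences T R + occurrences χ L * occurrences T R
occurrences-skew-split {χ} {m₁} {θ} {m₂} {a} {b} {n} {L} {R} χ<m₁ θ<m₂ XT a+b≡n hL hR =
  trans (occurrences-skew-insert χ<m₁ θ<m₂ XT (Layered-shift a b n L R a+b≡n hL hR))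
        (cong₂ _+_ (cong₂ (λ x y → x + occurrences (X ++ T) R + y * occurrences T R)
                          (occurrences-shift-text (X ++ T) b L) (occurrences-shift-text X b L))
                   (cong (_* occurrences T R) (occurrences-shift-text χ b L)))
  where
  X = χ ∷ʳ m₁
  T = θ ∷ʳ m₂

F-maxEnding-solves : ∀ {τ m} → All (_< m) τ → Solves (F (τ ∷ʳ m)) (K (F τ))
F-maxEnding-solves {τ} {m} τ<m zero    = F-zero (τ ∷ʳ m) (orderIso-[]-∷ʳ τ m [])
F-maxEnding-solves {τ} {m} τ<m (suc n) = begin
  ∑Av (suc n) (occurrences σ)
    ≡⟨ decomposition n (occurrences σ) ⟩
  ∑pairs n (λ a b → ∑Av² a b (λ L R → occurrences σ (shift b L ++ suc n ∷ R)))
    ≡⟨ ∑pairs-cong n (λ a b a+b≡n → ∑Av-congᴾ a (λ L hL → ∑Av-congᴾ b (λ R hR →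
         trans (occurrences-maxEnding-split τ<m a+b≡n hL hR) (units (occurrences σ L) (occurrences σ R) (occurrences τ L))))) ⟩
  ∑pairs n (λ a b → ∑Av² a b (λ L R → occurrences σ L * 1 + 1 * occurrences σ R + occurrences τ L * 1))
    ≡⟨ ∑pairs-cong n (λ a b _ → trans (∑Av²-+ a b _ _) (cong₂ _+_ (trans (∑Av²-+ a b _ _)
         (cong₂ _+_ (∑Av²-* a b _ _) (∑Av²-* a b _ _))) (∑Av²-* a b _ _))) ⟩
  ∑pairs n (λ a b → F σ a * catalan b + catalan a * F σ b + F τ a * catalan b)
    ≡⟨ trans (∑pairs-+ n _ _) (cong (_+ (F τ ⋆ catalan) n) (∑pairs-+ n _ _)) ⟩
  (F σ ⋆ catalan) n + (catalan ⋆ F σ) n + (F τ ⋆ catalan) n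
    ≡⟨ cong₂ _+_ (cong (_+ (catalan ⋆ F σ) n) (⋆-comm (F σ) catalan n)) (⋆-comm (F τ) catalan n) ⟩
  K (F σ) (suc n) + K (F σ) (suc n) + K (F τ) (suc n) ∎
  where
  open ≡-Reasoning
  σ = τ ∷ʳ m
  units : ∀ x y z → x + y + z ≡ x * 1 + 1 * y + z * 1
  units = solve-∀

F-skew-solves : ∀ {χ m₁ θ m₂} → All (_< m₁) χ → All (_< m₂) θ → Above (χ ∷ʳ m₁) (θ ∷ʳ m₂) →
  let X = χ ∷ʳ m₁; T = θ ∷ʳ m₂ in
  Solves (F (X ++ T)) (x· ((F X ⊞ F χ) ⋆ F T))
F-skew-solves {χ} {m₁} {θ} {m₂} χ<m₁ θ<m₂ XT zero    =
  F-zero ((χ ∷ʳ m₁) ++ θ ∷ʳ m₂) (Skew.orderIso-[]-X++T χ<m₁ θ<m₂ XT)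
F-skew-solves {χ} {m₁} {θ} {m₂} χ<m₁ θ<m₂ XT (suc n) = begin
  ∑Av (suc n) (occurrences σ)
    ≡⟨ decomposition n (occurrences σ) ⟩
  ∑pairs n (λ a b → ∑Av² a b (λ L R → occurrences σ (shift b L ++ suc n ∷ R)))
    ≡⟨ ∑pairs-cong n (λ a b a+b≡n → ∑Av-congᴾ a (λ L hL → ∑Av-congᴾ b (λ R hR →
         trans (occurrences-skew-split χ<m₁ θ<m₂ XT a+b≡n hL hR)
               (units (occurrences σ L) (occurrences σ R)
                      (occurrences X L * occurrences T R) (occurrences χ L * occurrences T R))))) ⟩
  ∑pairs n (λ a b → ∑Av² a b (λ L R →
    occurrences σ L * 1 + 1 * occurrences σ R + occurrences X L * occurrences T R + occurrences χ L * occurrences T R))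
    ≡⟨ ∑pairs-cong n (λ a b _ →
         trans (∑Av²-+ a b _ _) (cong₂ _+_
           (trans (∑Av²-+ a b _ _) (cong₂ _+_
             (trans (∑Av²-+ a b _ _) (cong₂ _+_ (∑Av²-* a b _ _) (∑Av²-* a b _ _)))
             (∑Av²-* a b _ _)))
           (∑Av²-* a b _ _))) ⟩
  ∑pairs n (λ a b → F σ a * catalan b + catalan a * F σ b + F X a * F T b + F χ a * F T b)
    ≡⟨ trans (∑pairs-+ n _ _)
         (cong (_+ (F χ ⋆ F T) n) (trans (∑pairs-+ n _ _) (cong (_+ (F X ⋆ F T) n) (∑pairs-+ n _ _)))) ⟩
  (F σ ⋆ catalan) n + (catalan ⋆ F σ) n + (F X ⋆ F T) n + (F χ ⋆ F T) n
    ≡⟨ cong (λ k → k + (catalan ⋆ F σ) n + (F X ⋆ F T) n + (F χ ⋆ F T) n) (⋆-comm (F σ) catalan n) ⟩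
  K (F σ) (suc n) + K (F σ) (suc n) + (F X ⋆ F T) n + (F χ ⋆ F T) n
    ≡⟨ +-assoc (K (F σ) (suc n) + K (F σ) (suc n)) _ _ ⟩
  K (F σ) (suc n) + K (F σ) (suc n) + ((F X ⋆ F T) n + (F χ ⋆ F T) n)
    ≡⟨ cong (K (F σ) (suc n) + K (F σ) (suc n) +_) (sym (⋆-distribʳ-⊞ (F X) (F χ) (F T) n)) ⟩
  K (F σ) (suc n) + K (F σ) (suc n) + ((F X ⊞ F χ) ⋆ F T) n ∎
  where
  open ≡-Reasoning
  X = χ ∷ʳ m₁
  T = θ ∷ʳ m₂
  σ = X ++ T
  units : ∀ x y z w → x + y + z + w ≡ x * 1 + 1 * y + z + w
  units = solve-∀

-- Appending increasing patterns

InRange : List ℕ → Set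
InRange P = All (λ x → 1 ≤ x × x ≤ length P) P

inc-suc : ∀ w → inc (suc w) ≡ inc w ∷ʳ suc w
inc-suc w = trans (cong (map suc) (sym (upTo-∷ʳ w))) (map-++ suc (upTo w) (w ∷ []))

inc-InRange : ∀ w → All (λ x → 1 ≤ x × x ≤ w) (inc w)
inc-InRange zero    = []
inc-InRange (suc w) = subst (All (λ x → 1 ≤ x × x ≤ suc w)) (sym (inc-suc w))
  (All.++⁺ (All.map (λ (1≤x , x≤w) → 1≤x , m≤n⇒m≤1+n x≤w) (inc-InRange w)) ((s≤s z≤n , ≤-refl) ∷ []))

length-⊕-inc : ∀ P w → length (P ⊕ inc w) ≡ length P + w
length-⊕-inc P w = trans (length-++ P)
  (cong (length P +_) (trans (length-map _ (inc w)) (trans (length-map suc (upTo w)) (length-upTo w))))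

length-⊖ : ∀ P Q → length (P ⊖ Q) ≡ length P + length Q
length-⊖ P Q = trans (length-++ (map _ P)) (cong (_+ length Q) (length-map _ P))

InRange-⊕-inc : ∀ P w → InRange P → InRange (P ⊕ inc w)
InRange-⊕-inc P w hP rewrite length-⊕-inc P w =
  All.++⁺ (All.map (λ (1≤x , x≤P) → 1≤x , ≤-trans x≤P (m≤m+n (length P) w)) hP)
          (All.map⁺ (All.map (λ {x} (1≤x , x≤w) → ≤-trans 1≤x (m≤m+n x (length P)) ,
                                                 subst (x + length P ≤_) (+-comm w (length P)) (+-monoˡ-≤ (length P) x≤w))
                             (inc-InRange w)))

InRange-⊖ : ∀ P Q → InRange P → InRange Q → InRange (P ⊖ Q)
InRange-⊖ P Q hP hQ rewrite length-⊖ P Q =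
  All.++⁺ (All.map⁺ (All.map (λ (1≤x , x≤P) → ≤-trans 1≤x (m≤m+n _ (length Q)) , +-monoˡ-≤ (length Q) x≤P) hP))
          (All.map (λ (1≤z , z≤Q) → 1≤z , ≤-trans z≤Q (m≤n+m (length Q) (length P))) hQ)

⊕-inc-suc : ∀ P w → P ⊕ inc (suc w) ≡ (P ⊕ inc w) ∷ʳ (suc w + length P)
⊕-inc-suc P w = trans (cong (λ i → P ++ map (_+ length P) i) (inc-suc w))
  (trans (cong (P ++_) (map-++ (_+ length P) (inc w) (suc w ∷ []))) (sym (++-assoc P _ _)))

⊕-inc-below : ∀ P w → InRange P → All (_< suc w + length P) (P ⊕ inc w)
⊕-inc-below P w hP = All.++⁺ (All.map (λ (_ , x≤P) → s≤s (≤-trans x≤P (m≤n+m (length P) w))) hP)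
  (All.map⁺ (All.map (λ (_ , x≤w) → +-monoˡ-< (length P) (s≤s x≤w)) (inc-InRange w)))

init-last : ∀ xs → NonEmpty xs → Σ (List ℕ) λ ys → xs ≡ ys ∷ʳ lastEntry xs
init-last (x ∷ [])     _ = [] , refl
init-last (x ∷ y ∷ ys) _ with init-last (y ∷ ys) (s≤s z≤n)
... | zs , e = x ∷ zs , cong (x ∷_) e

Unique-∷ʳ⇒≢ : ∀ ys {m : ℕ} → Unique (ys ∷ʳ m) → All (_≢ m) ys
Unique-∷ʳ⇒≢ []       _          = []
Unique-∷ʳ⇒≢ (y ∷ ys) (y∉ ∷ u) = All.lookup y∉ (∈-++⁺ʳ ys (here refl)) ∷ Unique-∷ʳ⇒≢ ys u

init-below-largest : ∀ q → IsPerm q → NonEmpty q → EndsInLargest q →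
  Σ (List ℕ) λ q⁻ → q ≡ q⁻ ∷ʳ lastEntry q × All (_< lastEntry q) q⁻
init-below-largest q (u , _) ne ≤last with init-last q ne
... | q⁻ , q≡ = q⁻ , q≡ , All.zipWith (λ (x≤m , x≢m) → ≤∧≢⇒< x≤m x≢m)
  (All.++⁻ˡ q⁻ (subst (All (_≤ lastEntry q)) q≡ ≤last) , Unique-∷ʳ⇒≢ q⁻ (subst Unique q≡ u))

F-⊕-inc-solves : ∀ P w → InRange P → Solves (F (P ⊕ inc (suc w))) (K (F (P ⊕ inc w)))
F-⊕-inc-solves P w hP =
  Solves-resp (F-maxEnding-solves (⊕-inc-below P w hP)) (F-cong (sym (⊕-inc-suc P w))) (λ _ → refl)

module IncreasingSuffix {q q⁻ t t⁻ : List ℕ} {m m′ : ℕ}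
    (q-range : InRange q) (q≡ : q ≡ q⁻ ∷ʳ m) (q⁻<m : All (_< m) q⁻)
    (t-range : InRange t) (t≡ : t ≡ t⁻ ∷ʳ m′) (t⁻<m′ : All (_< m′) t⁻) where

  init : ℕ → List ℕ
  init zero    = q⁻
  init (suc j) = q ⊕ inc j

  top : ℕ → ℕ
  top zero    = m
  top (suc j) = suc j + length q

  q⊕inc≡ : ∀ v → q ⊕ inc v ≡ init v ∷ʳ top v
  q⊕inc≡ zero    = trans (++-identityʳ q) q≡
  q⊕inc≡ (suc j) = ⊕-inc-suc q j

  init<top : ∀ v → All (_< top v) (init v)
  init<top zero    = q⁻<m
  init<top (suc j) = ⊕-inc-below q j q-range

  Q : ℕ → Seq
  Q v = F (init v)

  Q-solves : ∀ v → Solves (Q (suc v)) (K (Q v))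
  Q-solves v = Solves-resp (F-maxEnding-solves (init<top v)) (F-cong (sym (q⊕inc≡ v))) (λ _ → refl)

  Y : ℕ → List ℕ
  Y v = (q ⊕ inc v) ⊖ t

  Y-range : ∀ v → InRange (Y v)
  Y-range v = InRange-⊖ (q ⊕ inc v) t (InRange-⊕-inc q v q-range) t-range

  Y-solves : ∀ v → Solves (F (Y v)) (x⋆ (F t) (Q (suc v) ⊞ Q v))
  Y-solves v = Solves-resp (F-skew-solves χ<m₁ t⁻<m′ X-above-T) (F-cong (cong₂ _++_ X≡ (sym t≡))) inhomogeneity
    where
    k = length t
    χ = shift k (init v)
    m₁ = top v + k
    χ<m₁ : All (_< m₁) χ
    χ<m₁ = All.map⁺ (All.map (+-monoˡ-< k) (init<top v))
    X≡ : χ ∷ʳ m₁ ≡ shift k (q ⊕ inc v)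
    X≡ = trans (sym (map-++ (_+ k) (init v) (top v ∷ []))) (cong (shift k) (sym (q⊕inc≡ v)))
    X-above-T : Above (χ ∷ʳ m₁) (t⁻ ∷ʳ m′)
    X-above-T = subst₂ Above (sym X≡) t≡
      (All.map⁺ (All.map (λ (1≤x , _) → All.map (λ (_ , z≤k) → ≤-trans (s≤s z≤k) (+-monoˡ-≤ k 1≤x)) t-range)
                         (InRange-⊕-inc q v q-range)))
    inhomogeneity : x· ((F (χ ∷ʳ m₁) ⊞ F χ) ⋆ F (t⁻ ∷ʳ m′)) ≈ x⋆ (F t) (Q (suc v) ⊞ Q v)
    inhomogeneity = x·-cong (≈-trans
      (⋆-cong (λ n → cong₂ _+_ (trans (F-cong X≡ n) (F-shift (q ⊕ inc v) k n)) (F-shift (init v) k n))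
              (F-cong (sym t≡)))
      (⋆-comm (Q (suc v) ⊞ Q v) (F t)))

  -- Both sides solve the recurrence with inhomogeneity K (x⋆ (F t) (Q (suc v) ⊞ Q v)).
  Y-solves-step : ∀ v → Solves (F (Y (suc v))) (K (F (Y v)))
  Y-solves-step v = Solves-resp (Y-solves (suc v)) (λ _ → refl) (solution-unique shifted unshifted (λ _ → refl))
    where
    shifted : Solves (x⋆ (F t) (Q (suc (suc v)) ⊞ Q (suc v))) (K (x⋆ (F t) (Q (suc v) ⊞ Q v)))
    shifted = Solves-resp (Solves-x⋆ (F t) (Solves-⊞ (Q-solves (suc v)) (Q-solves v))) (λ _ → refl)
      (≈-trans (x⋆-cong (F t) (≈-sym (x⋆-⊞ catalan (Q (suc v)) (Q v)))) (x⋆-comm (F t) catalan (Q (suc v) ⊞ Q v)))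
    unshifted : Solves (K (F (Y v))) (K (x⋆ (F t) (Q (suc v) ⊞ Q v)))
    unshifted = Solves-x⋆ catalan (Y-solves v)

  F-Y≈F-Y₀⊕inc : ∀ v → F (Y v) ≈ F (Y 0 ⊕ inc v)
  F-Y≈F-Y₀⊕inc zero    = F-cong (sym (++-identityʳ (Y 0)))
  F-Y≈F-Y₀⊕inc (suc v) =
    solution-unique (Y-solves-step v) (F-⊕-inc-solves (Y 0) v (Y-range 0)) (x⋆-cong catalan (F-Y≈F-Y₀⊕inc v))

  F-Y⊕inc≈F-Y₀⊕inc : ∀ v w → F (Y v ⊕ inc w) ≈ F (Y 0 ⊕ inc (v + w))
  F-Y⊕inc≈F-Y₀⊕inc v zero    = ≈-trans (F-cong (++-identityʳ (Y v)))
                         (≈-trans (F-Y≈F-Y₀⊕inc v) (F-cong (cong (λ k → Y 0 ⊕ inc k) (sym (+-identityʳ v)))))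
  F-Y⊕inc≈F-Y₀⊕inc v (suc w) = solution-unique (F-⊕-inc-solves (Y v) w (Y-range v))
    (subst (λ k → Solves (F (Y 0 ⊕ inc k)) (K (F (Y 0 ⊕ inc (v + w))))) (sym (+-suc v w))
           (F-⊕-inc-solves (Y 0) (v + w) (Y-range 0)))
    (x⋆-cong catalan (F-Y⊕inc≈F-Y₀⊕inc v w))

-- The identity holds for every v ≤ u and every n.
mainTheorem4 : (q t : List ℕ) → IsPerm q → NonEmpty q → EndsInLargest q
    → IsPerm t → NonEmpty t → EndsInLargest t
    → (u v : ℕ) → 1 ≤ v → v < u
    → (n : ℕ) → 1 ≤ n
    → S n (1 ∷ 3 ∷ 2 ∷ []) (((q ⊕ inc v) ⊖ t) ⊕ inc (u ∸ v))
    ≡ S n (1 ∷ 3 ∷ 2 ∷ []) ((q ⊖ t) ⊕ inc u)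
mainTheorem4 q t q-perm q≢[] q-last t-perm t≢[] t-last u v _ v<u n _
  with init-below-largest q q-perm q≢[] q-last | init-below-largest t t-perm t≢[] t-last
... | q⁻ , q≡ , q⁻<m | t⁻ , t≡ , t⁻<m′ = begin
  S n p132 (((q ⊕ inc v) ⊖ t) ⊕ inc (u ∸ v))  ≡⟨ S≡F n _ ⟩
  F (Y v ⊕ inc (u ∸ v)) n                      ≡⟨ F-Y⊕inc≈F-Y₀⊕inc v (u ∸ v) n ⟩
  F (Y 0 ⊕ inc (v + (u ∸ v))) n
    ≡⟨ cong₂ (λ P k → F ((P ⊖ t) ⊕ inc k) n) (++-identityʳ q) (m+[n∸m]≡n (<⇒≤ v<u)) ⟩
  F ((q ⊖ t) ⊕ inc u) n                        ≡⟨ sym (S≡F n _) ⟩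
  S n p132 ((q ⊖ t) ⊕ inc u)                   ∎
  where
  open ≡-Reasoning
  open IncreasingSuffix (proj₂ q-perm) q≡ q⁻<m (proj₂ t-perm) t≡ t⁻<m′
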